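{- Let $\{H_n(x)\}_{n\geq0}$ be defined by $H_0(x)=1$ and $$H_{n+1}(x)=(2nx^2+x+1)H_n(x)+2x(1-x^2)H_n'(x)\quad(n\ge0).$$ Then $H_n(x)=U_n(x^2)+xV_n(x^2)$ for all $n\ge0$.
   Context: $\mathcal{S}^B_n$ is the set of signed permutations $\pi$ of $\pm[n]$ with $\pi(-i)=-\pi(i)$, written $\pi=\pi(1)\cdots\pi(n)$, entries compared in the usual integer order, with the convention $\pi(0)=0$. Define ${\rm pk}(\pi)=\#\{i\in[n-1]:\pi(i-1)<\pi(i)>\pi(i+1)\}$ and ${\rm val}(\pi)=\#\{i\in[n-1]:\pi(i-1)>\pi(i)<\pi(i+1)\}$. Let $C_n^+=\{\pi\in\mathcal{S}^B_n:\pi(1)>0\}$, $U_n(x)=\sum_{\pi\in C_n^+}x^{{\rm pk}(\pi)}$, $V_n(x)=\sum_{\pi\in C_n^+}x^{{\rm val}(\pi)}$, with $U_0(x)=1$, $V_0(x)=0$. -}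

module Defs where

open import Data.Nat as ℕ using (ℕ; zero; suc)
open import Data.Integer as ℤ using (ℤ; +_; 0ℤ; 1ℤ)
open import Data.List using (List; []; _∷_; map; concatMap; filter; length; upTo; sum; applyUpTo)
open import Data.List.Relation.Unary.Unique.Propositional using (Unique)
open import Data.List.Relation.Unary.Unique.Propositional.Properties using ()
open import Data.List.Relation.Unary.Unique.DecPropositional ℕ._≟_ using (unique?)
open import Data.Bool using (Bool; true; false; if_then_else_; _∧_)
open import Relation.Nullary.Decidable using (⌊_⌋)
open import Data.Nat.Properties using ()

-- Polynomials with integer coefficients, as coefficient sequences:
-- p k is the coefficient of x^k.

Poly : Set
Poly = ℕ → ℤ

constP : ℤ → Poly
constP c zero    = c
constP c (suc _) = 0ℤ

X : Poly
X 1 = 1ℤ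
X _ = 0ℤ

_+P_ : Poly → Poly → Poly
(p +P q) k = p k ℤ.+ q k

_-P_ : Poly → Poly → Poly
(p -P q) k = p k ℤ.- q k

_*P_ : Poly → Poly → Poly
(p *P q) k = Data.List.foldr ℤ._+_ 0ℤ (map (λ i → p i ℤ.* q (k ℕ.∸ i)) (upTo (suc k)))

deriv : Poly → Poly
deriv p k = + (suc k) ℤ.* p (suc k)

subst-x² : Poly → Poly
subst-x² p k = if ⌊ k ℕ.% 2 ℕ.≟ 0 ⌋ then p (k ℕ./ 2) else 0ℤ

infixl 6 _+P_ _-P_
infixl 7 _*P_

H : ℕ → Poly
H zero    = constP 1ℤ
H (suc n) = (constP (+ (2 ℕ.* n)) *P X *P X +P X +P constP 1ℤ) *P H n
          +P (constP (+ 2) *P X *P (constP 1ℤ -P X *P X)) *P deriv (H n)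

-- Signed permutations of ±[n], written as the word π(1)⋯π(n) of integers.

words : {A : Set} → List A → ℕ → List (List A)
words A zero    = [] ∷ []
words A (suc n) = concatMap (λ a → map (a ∷_) (words A n)) A

±[_] : ℕ → List ℤ
±[ n ] = applyUpTo (λ i → ℤ.- (+ suc i)) n Data.List.++ applyUpTo (λ i → + suc i) n

isSignedPerm : List ℤ → Bool
isSignedPerm w = ⌊ unique? (map ℤ.∣_∣ w) ⌋

signedPerms : ℕ → List (List ℤ)
signedPerms n = filter (λ w → Data.Bool._≟_ (isSignedPerm w) true) (words ±[ n ] n)

firstPositive : List ℤ → Bool
firstPositive []      = false
firstPositive (a ∷ _) = ⌊ 0ℤ ℤ.<? a ⌋

Cplus : ℕ → List (List ℤ)
Cplus n = filter (λ w → Data.Bool._≟_ (firstPositive w) true) (signedPerms n)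

peaksL : List ℤ → ℕ
peaksL (a ∷ b ∷ c ∷ l) =
  (if ⌊ a ℤ.<? b ⌋ ∧ ⌊ c ℤ.<? b ⌋ then 1 else 0) ℕ.+ peaksL (b ∷ c ∷ l)
peaksL _ = 0

valleysL : List ℤ → ℕ
valleysL (a ∷ b ∷ c ∷ l) =
  (if ⌊ b ℤ.<? a ⌋ ∧ ⌊ b ℤ.<? c ⌋ then 1 else 0) ℕ.+ valleysL (b ∷ c ∷ l)
valleysL _ = 0

-- pk(π), val(π) with the convention π(0) = 0; i ranges over [n-1]
pk : List ℤ → ℕ
pk π = peaksL (0ℤ ∷ π)

val : List ℤ → ℕ
val π = valleysL (0ℤ ∷ π)

countStat : (List ℤ → ℕ) → List (List ℤ) → ℕ → ℕ
countStat st ws k = length (filter (λ w → st w ℕ.≟ k) ws)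

U : ℕ → Poly
U zero    = constP 1ℤ
U (suc n) k = + countStat pk (Cplus (suc n)) k

V : ℕ → Poly
V zero    = constP 0ℤ
V (suc n) k = + countStat val (Cplus (suc n)) k

-- Split H_n into even and odd parts, H_n = A_n(x²) + x B_n(x²). Comparing coefficients, the
-- recurrence for H_n says that (A_n, B_n) evolves by a linear recurrence involving only A_n, B_n and
-- their derivatives, so it suffices that (U_n, V_n) obeys the same recurrence and starts at (1, 0).
--
-- Every signed permutation of [n+1] arises exactly once by inserting n+1 or -(n+1) into one of the
-- n+1 slots of a signed permutation of [n]. Inserting an extreme letter raises the number of peaks
-- (with π(0) = 0) by 0 or 1, and summing over the slots shows that exactly 2 pk + 1 of them keep it
-- (one more for a minimum when π(1) < 0). Keeping track of the sign of the first letter, this gives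
-- the recurrence; valleys of π are the peaks of -π, so V_n counts by peaks the signed permutations
-- whose first letter is negative.

module Submission where

open import Defs
open import Data.Nat as ℕ using (ℕ; zero; suc; s≤s; z≤n)
import Data.Nat.Properties as ℕP
open import Data.Nat.DivMod using (m*n%n≡0; m*n/n≡m; [m+kn]%n≡m%n)
open import Data.Integer as ℤ using (ℤ; +_; 0ℤ; 1ℤ; -[1+_]; +<+; -<+; -<-)
import Data.Integer.Properties as ℤP
open import Data.Bool using (Bool; true; false; if_then_else_; _∧_; not)
import Data.Bool
import Data.Bool.Properties as BoolP
open import Data.List using (List; []; _∷_; [_]; map; foldr; length; _++_; concatMap; filter; applyUpTo)
import Data.List.Properties as ListP
open import Data.List.Membership.Propositional using (_∈_; _∉_; find; lose)
open import Data.List.Membership.Propositional.Properties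
  using (∈-concatMap⁺; ∈-concatMap⁻; ∈-map⁺; ∈-map⁻; ∈-++⁺ˡ; ∈-++⁺ʳ; ∈-++⁻; ∈-∃++;
         ∈-applyUpTo⁺; ∈-applyUpTo⁻; ∈-filter⁺; ∈-filter⁻)
open import Data.List.Membership.Propositional.Properties.WithK using (unique∧set⇒bag)
open import Data.List.Relation.Binary.BagAndSetEquality using (∼bag⇒↭)
open import Data.List.Relation.Binary.Permutation.Propositional as ↭ using (_↭_; ↭-refl; ↭-sym; ↭-trans)
import Data.List.Relation.Binary.Permutation.Propositional.Properties as ↭P
import Data.List.Relation.Binary.Permutation.Setoid.Properties as ↭S
open import Data.List.Relation.Unary.All as All using (All; []; _∷_)
import Data.List.Relation.Unary.All.Properties as AllP
open import Data.List.Relation.Unary.All.Properties.Core using (¬Any⇒All¬)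
open import Data.List.Relation.Unary.Any as Any using (here; there)
open import Data.List.Relation.Unary.Linked using (Linked; []; [-]; _∷_)
open import Data.List.Relation.Unary.Unique.Propositional using (Unique; []; _∷_)
import Data.List.Relation.Unary.Unique.Propositional.Properties as UniqueP
open import Data.List.Relation.Unary.Unique.DecPropositional ℕ._≟_ using (unique?)
open import Data.Sum using (_⊎_; inj₁; inj₂)
open import Data.Product using (_×_; _,_; proj₁; proj₂; ∃-syntax; ∃₂)
open import Data.Empty using (⊥-elim)
open import Function using (_∘_; id; mk⇔; Equivalence)
open import Level using (0ℓ)
open import Relation.Nullary using (¬_; Dec; yes; no)
open import Relation.Nullary.Decidable using (⌊_⌋; isYes≗does; dec-true; dec-false; toWitness)
open import Relation.Unary using (Pred)
open import Relation.Binary.Definitions using (tri<; tri≈; tri>)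
open import Relation.Binary.PropositionalEquality
  using (_≡_; _≢_; refl; sym; trans; cong; cong₂; subst; setoid; module ≡-Reasoning)
import Data.Nat.Tactic.RingSolver as ℕSolver
import Data.Integer.Tactic.RingSolver as ℤSolver

private
  variable
    A B : Set

-- The recurrence for H, coefficientwise

sumBelow : (ℕ → ℤ) → ℕ → ℤ
sumBelow f zero    = 0ℤ
sumBelow f (suc n) = f 0 ℤ.+ sumBelow (f ∘ suc) n

sum-map-applyUpTo : ∀ (g : ℕ → ℤ) f n →
  foldr ℤ._+_ 0ℤ (map g (applyUpTo f n)) ≡ sumBelow (g ∘ f) n
sum-map-applyUpTo g f zero    = refl
sum-map-applyUpTo g f (suc n) = cong (ℤ._+_ (g (f 0))) (sum-map-applyUpTo g (f ∘ suc) n)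

*P-coeff : ∀ p q k → (p *P q) k ≡ sumBelow (λ i → p i ℤ.* q (k ℕ.∸ i)) (suc k)
*P-coeff p q k = sum-map-applyUpTo (λ i → p i ℤ.* q (k ℕ.∸ i)) id (suc k)

sumBelow-zero : ∀ f n → (∀ i → f i ≡ 0ℤ) → sumBelow f n ≡ 0ℤ
sumBelow-zero f zero    f≡0 = refl
sumBelow-zero f (suc n) f≡0 =
  cong₂ ℤ._+_ (f≡0 0) (sumBelow-zero (f ∘ suc) n (f≡0 ∘ suc))

shift : Poly → Poly
shift q zero    = 0ℤ
shift q (suc k) = q k

*P-cubic : ∀ {a₀ a₁ a₂ a₃} p q → p 0 ≡ a₀ → p 1 ≡ a₁ → p 2 ≡ a₂ → p 3 ≡ a₃ →
  (∀ i → p (4 ℕ.+ i) ≡ 0ℤ) → ∀ k →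
  (p *P q) k ≡ a₀ ℤ.* q k ℤ.+ a₁ ℤ.* shift q k ℤ.+ a₂ ℤ.* shift (shift q) k
               ℤ.+ a₃ ℤ.* shift (shift (shift q)) k
*P-cubic p q refl refl refl refl p≥4≡0 k = trans (*P-coeff p q k) (cases k)
  where
  cases : ∀ k → sumBelow (λ i → p i ℤ.* q (k ℕ.∸ i)) (suc k)
              ≡ p 0 ℤ.* q k ℤ.+ p 1 ℤ.* shift q k ℤ.+ p 2 ℤ.* shift (shift q) k
                ℤ.+ p 3 ℤ.* shift (shift (shift q)) k
  cases 0 = lemma (p 0 ℤ.* q 0) (p 1) (p 2) (p 3)
    where lemma : ∀ a b c d → a ℤ.+ 0ℤ ≡ a ℤ.+ b ℤ.* 0ℤ ℤ.+ c ℤ.* 0ℤ ℤ.+ d ℤ.* 0ℤ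
          lemma = ℤSolver.solve-∀
  cases 1 = lemma (p 0 ℤ.* q 1) (p 1 ℤ.* q 0) (p 2) (p 3)
    where lemma : ∀ a b c d → a ℤ.+ (b ℤ.+ 0ℤ) ≡ a ℤ.+ b ℤ.+ c ℤ.* 0ℤ ℤ.+ d ℤ.* 0ℤ
          lemma = ℤSolver.solve-∀
  cases 2 = lemma (p 0 ℤ.* q 2) (p 1 ℤ.* q 1) (p 2 ℤ.* q 0) (p 3)
    where lemma : ∀ a b c d → a ℤ.+ (b ℤ.+ (c ℤ.+ 0ℤ)) ≡ a ℤ.+ b ℤ.+ c ℤ.+ d ℤ.* 0ℤ
          lemma = ℤSolver.solve-∀
  cases (suc (suc (suc k))) =
    trans (cong (λ z → p 0 ℤ.* q (3 ℕ.+ k) ℤ.+ (p 1 ℤ.* q (2 ℕ.+ k) ℤ.+ (p 2 ℤ.* q (1 ℕ.+ k)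
                         ℤ.+ (p 3 ℤ.* q k ℤ.+ z))))
                (sumBelow-zero _ k λ i → cong (ℤ._* q (k ℕ.∸ suc i)) (p≥4≡0 i)))
          (lemma (p 0 ℤ.* q (3 ℕ.+ k)) (p 1 ℤ.* q (2 ℕ.+ k)) (p 2 ℤ.* q (1 ℕ.+ k)) (p 3 ℤ.* q k))
    where lemma : ∀ a b c d → a ℤ.+ (b ℤ.+ (c ℤ.+ (d ℤ.+ 0ℤ))) ≡ a ℤ.+ b ℤ.+ c ℤ.+ d
          lemma = ℤSolver.solve-∀

constP-*P : ∀ c q k → (constP c *P q) k ≡ c ℤ.* q k
constP-*P c q k = trans (*P-cubic (constP c) q refl refl refl refl (λ _ → refl) k)
                        (lemma c (q k) (shift q k) (shift (shift q) k) (shift (shift (shift q)) k))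
  where lemma : ∀ c a b d e → c ℤ.* a ℤ.+ 0ℤ ℤ.* b ℤ.+ 0ℤ ℤ.* d ℤ.+ 0ℤ ℤ.* e ≡ c ℤ.* a
        lemma = ℤSolver.solve-∀

shift-as-*P : ∀ {a} p q → p 0 ≡ 0ℤ → p 1 ≡ a → p 2 ≡ 0ℤ → p 3 ≡ 0ℤ →
  (∀ i → p (4 ℕ.+ i) ≡ 0ℤ) → ∀ k → (p *P q) k ≡ a ℤ.* shift q k
shift-as-*P {a} p q p0 p1 p2 p3 p≥4 k = trans (*P-cubic p q p0 p1 p2 p3 p≥4 k)
  (lemma a (q k) (shift q k) (shift (shift q) k) (shift (shift (shift q)) k))
  where lemma : ∀ c a b d e → 0ℤ ℤ.* a ℤ.+ c ℤ.* b ℤ.+ 0ℤ ℤ.* d ℤ.+ 0ℤ ℤ.* e ≡ c ℤ.* b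
        lemma = ℤSolver.solve-∀

X-*P : ∀ q k → (X *P q) k ≡ shift q k
X-*P q k = trans (shift-as-*P X q refl refl refl refl (λ _ → refl) k) (ℤP.*-identityˡ (shift q k))

constP-X-*P : ∀ c q k → ((constP c *P X) *P q) k ≡ c ℤ.* shift q k
constP-X-*P c q k = shift-as-*P (constP c *P X) q (X-zero 0 refl) (trans (constP-*P c X 1) (ℤP.*-identityʳ c))
  (X-zero 2 refl) (X-zero 3 refl) (λ i → X-zero (4 ℕ.+ i) refl) k
  where
  X-zero : ∀ j → X j ≡ 0ℤ → (constP c *P X) j ≡ 0ℤ
  X-zero j Xj≡0 = trans (constP-*P c X j) (trans (cong (c ℤ.*_) Xj≡0) (ℤP.*-zeroʳ c))

stepH : ℕ → Poly → Poly
stepH n h k = h k ℤ.+ shift h k ℤ.+ + 2 ℤ.* + n ℤ.* shift (shift h) k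
              ℤ.+ + 2 ℤ.* shift (deriv h) k ℤ.- + 2 ℤ.* shift (shift (shift (deriv h))) k

H-suc : ∀ n k → H (suc n) k ≡ stepH n (H n) k
H-suc n k = trans (cong₂ ℤ._+_
    (*P-cubic α (H n) (α≡ 0 (lemma₀ c)) (α≡ 1 (lemma₁ c)) (α≡ 2 (lemma₂ c)) (α≡ 3 (lemma₃ c)) (λ i → α≡ (4 ℕ.+ i) (lemma₃ c)) k)
    (*P-cubic β (deriv (H n)) refl refl refl refl β≥4≡0 k))
  (trans (lemma c (H n k) (shift (H n) k) (shift (shift (H n)) k) (shift (shift (shift (H n))) k)
                (deriv (H n) k) (shift (deriv (H n)) k) (shift (shift (deriv (H n))) k)
                (shift (shift (shift (deriv (H n)))) k))
         (cong (λ c → H n k ℤ.+ shift (H n) k ℤ.+ c ℤ.* shift (shift (H n)) k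
                      ℤ.+ + 2 ℤ.* shift (deriv (H n)) k ℤ.- + 2 ℤ.* shift (shift (shift (deriv (H n)))) k)
               (ℤP.pos-* 2 n)))
  where
  c : ℤ
  c = + (2 ℕ.* n)
  α β : Poly
  α = constP c *P X *P X +P X +P constP 1ℤ
  β = constP (+ 2) *P X *P (constP 1ℤ -P X *P X)
  α≡ : ∀ j {a} → c ℤ.* shift X j ℤ.+ X j ℤ.+ constP 1ℤ j ≡ a →
       α j ≡ a
  α≡ j eq = trans (cong (λ z → z ℤ.+ X j ℤ.+ constP 1ℤ j) (constP-X-*P c X j)) eq
  lemma₀ : ∀ c → c ℤ.* 0ℤ ℤ.+ 0ℤ ℤ.+ 1ℤ ≡ 1ℤ
  lemma₀ = ℤSolver.solve-∀
  lemma₁ : ∀ c → c ℤ.* 0ℤ ℤ.+ 1ℤ ℤ.+ 0ℤ ≡ 1ℤ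
  lemma₁ = ℤSolver.solve-∀
  lemma₂ : ∀ c → c ℤ.* 1ℤ ℤ.+ 0ℤ ℤ.+ 0ℤ ≡ c
  lemma₂ = ℤSolver.solve-∀
  lemma₃ : ∀ c → c ℤ.* 0ℤ ℤ.+ 0ℤ ℤ.+ 0ℤ ≡ 0ℤ
  lemma₃ = ℤSolver.solve-∀
  β≥4≡0 : ∀ i → β (4 ℕ.+ i) ≡ 0ℤ
  β≥4≡0 i = trans (constP-X-*P (+ 2) (constP 1ℤ -P X *P X) (4 ℕ.+ i)) (cong (λ z → + 2 ℤ.* (0ℤ ℤ.- z)) (X-*P X (3 ℕ.+ i)))
  lemma : ∀ c a b d e f g h i → 1ℤ ℤ.* a ℤ.+ 1ℤ ℤ.* b ℤ.+ c ℤ.* d ℤ.+ 0ℤ ℤ.* e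
          ℤ.+ (0ℤ ℤ.* f ℤ.+ + 2 ℤ.* g ℤ.+ 0ℤ ℤ.* h ℤ.+ ℤ.- (+ 2) ℤ.* i)
          ≡ a ℤ.+ b ℤ.+ c ℤ.* d ℤ.+ + 2 ℤ.* g ℤ.- + 2 ℤ.* i
  lemma = ℤSolver.solve-∀

-- Even and odd parts

interleave : Poly → Poly → Poly
interleave u v = subst-x² u +P X *P subst-x² v

subst-x²-even : ∀ p j → subst-x² p (j ℕ.* 2) ≡ p j
subst-x²-even p j =
  trans (cong (λ r → if ⌊ r ℕ.≟ 0 ⌋ then p (j ℕ.* 2 ℕ./ 2) else 0ℤ) (m*n%n≡0 j 2))
        (cong p (m*n/n≡m j 2))

subst-x²-odd : ∀ p j → subst-x² p (suc (j ℕ.* 2)) ≡ 0ℤ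
subst-x²-odd p j =
  cong (λ r → if ⌊ r ℕ.≟ 0 ⌋ then p (suc (j ℕ.* 2) ℕ./ 2) else 0ℤ) ([m+kn]%n≡m%n 1 j 2)

interleave-even : ∀ u v j → interleave u v (j ℕ.* 2) ≡ u j
interleave-even u v j =
  trans (cong₂ ℤ._+_ (subst-x²-even u j) (trans (X-*P (subst-x² v) (j ℕ.* 2)) (shift-odd j)))
        (ℤP.+-identityʳ (u j))
  where
  shift-odd : ∀ j → shift (subst-x² v) (j ℕ.* 2) ≡ 0ℤ
  shift-odd zero    = refl
  shift-odd (suc j) = subst-x²-odd v j

interleave-odd : ∀ u v j → interleave u v (suc (j ℕ.* 2)) ≡ v j
interleave-odd u v j =
  trans (cong₂ ℤ._+_ (subst-x²-odd u j) (X-*P (subst-x² v) (suc (j ℕ.* 2))))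
        (trans (ℤP.+-identityˡ _) (subst-x²-even v j))

even-or-odd : ∀ k → (∃[ j ] k ≡ j ℕ.* 2) ⊎ (∃[ j ] k ≡ suc (j ℕ.* 2))
even-or-odd zero = inj₁ (0 , refl)
even-or-odd (suc k) with even-or-odd k
... | inj₁ (j , refl) = inj₂ (j , refl)
... | inj₂ (j , refl) = inj₁ (suc j , refl)

≗-interleave : ∀ (f u v : Poly) → (∀ j → f (j ℕ.* 2) ≡ u j) → (∀ j → f (suc (j ℕ.* 2)) ≡ v j) →
               ∀ k → f k ≡ interleave u v k
≗-interleave f u v f-even f-odd k with even-or-odd k
... | inj₁ (j , refl) = trans (f-even j) (sym (interleave-even u v j))
... | inj₂ (j , refl) = trans (f-odd j) (sym (interleave-odd u v j))

shift-deriv : ∀ h m → shift (deriv h) m ≡ + m ℤ.* h m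
shift-deriv h zero    = refl
shift-deriv h (suc m) = refl

stepH-≡ : ∀ n h k {a b c d e} → h k ≡ a → shift h k ≡ b → shift (shift h) k ≡ c →
          shift (deriv h) k ≡ d → shift (shift (shift (deriv h))) k ≡ e →
          stepH n h k ≡ a ℤ.+ b ℤ.+ + 2 ℤ.* + n ℤ.* c ℤ.+ + 2 ℤ.* d ℤ.- + 2 ℤ.* e
stepH-≡ n h k refl refl refl refl refl = refl

stepH-cong : ∀ n {h g : Poly} → (∀ k → h k ≡ g k) → ∀ k → stepH n h k ≡ stepH n g k
stepH-cong n {h} {g} h≗g k =
  stepH-≡ n h k (h≗g k) (shift-cong h≗g k) (shift-cong (shift-cong h≗g) k)
          (shift-cong deriv-cong k) (shift-cong (shift-cong (shift-cong deriv-cong)) k)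
  where
  shift-cong : ∀ {p q : Poly} → (∀ k → p k ≡ q k) → ∀ k → shift p k ≡ shift q k
  shift-cong p≗q zero    = refl
  shift-cong p≗q (suc k) = p≗q k
  deriv-cong : ∀ k → deriv h k ≡ deriv g k
  deriv-cong k = cong (+ suc k ℤ.*_) (h≗g (suc k))

-- The coefficientwise form of  u′ = (1 + 2nx) u + 4x(1 - x) Du + x v  and
-- v′ = u + (3 + (2n - 2)x) v + 4x(1 - x) Dv, D the derivative.
record EvenOddRecurrence (n : ℕ) (u v u′ v′ : Poly) : Set where
  field
    u′-zero : u′ 0 ≡ u 0
    u′-suc  : ∀ j → u′ (suc j) ≡ (+ 4 ℤ.* + suc j ℤ.+ 1ℤ) ℤ.* u (suc j)
                                 ℤ.+ (+ 2 ℤ.* + n ℤ.- + 4 ℤ.* + j) ℤ.* u j ℤ.+ v j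
    v′-zero : v′ 0 ≡ u 0 ℤ.+ + 3 ℤ.* v 0
    v′-suc  : ∀ j → v′ (suc j) ≡ u (suc j) ℤ.+ (+ 4 ℤ.* + suc j ℤ.+ + 3) ℤ.* v (suc j)
                                 ℤ.+ (+ 2 ℤ.* + n ℤ.- + 4 ℤ.* + j ℤ.- + 2) ℤ.* v j

module _ {n : ℕ} {u v u′ v′ : Poly} (rec : EvenOddRecurrence n u v u′ v′) where

  open EvenOddRecurrence rec

  private
    w : Poly
    w = interleave u v

  stepH-interleave-even : ∀ j → stepH n (interleave u v) (j ℕ.* 2) ≡ u′ j
  stepH-interleave-even zero = trans (stepH-≡ n w 0 (interleave-even u v 0) refl refl refl refl)
                    (trans (lemma (u 0) (+ n)) (sym u′-zero))
    where lemma : ∀ a n → a ℤ.+ 0ℤ ℤ.+ + 2 ℤ.* n ℤ.* 0ℤ ℤ.+ + 2 ℤ.* 0ℤ ℤ.- + 2 ℤ.* 0ℤ ≡ a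
          lemma = ℤSolver.solve-∀
  stepH-interleave-even (suc j) =
    trans (stepH-≡ n w (suc j ℕ.* 2) (interleave-even u v (suc j)) (interleave-odd u v j)
                   (interleave-even u v j) (cong (+ (suc j ℕ.* 2) ℤ.*_) (interleave-even u v (suc j)))
                   (trans (shift-deriv w (j ℕ.* 2)) (cong (+ (j ℕ.* 2) ℤ.*_) (interleave-even u v j))))
          (trans (lemma (u (suc j)) (u j) (v j) (+ n) (+ j) (ℤP.pos-* j 2)) (sym (u′-suc j)))
    where lemma : ∀ u₁ u₀ v₀ n j {j2} → j2 ≡ j ℤ.* + 2 →
                  u₁ ℤ.+ v₀ ℤ.+ + 2 ℤ.* n ℤ.* u₀ ℤ.+ + 2 ℤ.* ((+ 2 ℤ.+ j2) ℤ.* u₁) ℤ.- + 2 ℤ.* (j2 ℤ.* u₀)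
                  ≡ (+ 4 ℤ.* (1ℤ ℤ.+ j) ℤ.+ 1ℤ) ℤ.* u₁ ℤ.+ (+ 2 ℤ.* n ℤ.- + 4 ℤ.* j) ℤ.* u₀ ℤ.+ v₀
          lemma u₁ u₀ v₀ n j refl = algebra u₁ u₀ v₀ n j
            where algebra : ∀ u₁ u₀ v₀ n j →
                    u₁ ℤ.+ v₀ ℤ.+ + 2 ℤ.* n ℤ.* u₀ ℤ.+ + 2 ℤ.* ((+ 2 ℤ.+ j ℤ.* + 2) ℤ.* u₁)
                    ℤ.- + 2 ℤ.* (j ℤ.* + 2 ℤ.* u₀)
                    ≡ (+ 4 ℤ.* (1ℤ ℤ.+ j) ℤ.+ 1ℤ) ℤ.* u₁ ℤ.+ (+ 2 ℤ.* n ℤ.- + 4 ℤ.* j) ℤ.* u₀ ℤ.+ v₀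
                  algebra = ℤSolver.solve-∀
  stepH-interleave-odd : ∀ j → stepH n (interleave u v) (suc (j ℕ.* 2)) ≡ v′ j
  stepH-interleave-odd zero = trans (stepH-≡ n w 1 (interleave-odd u v 0) (interleave-even u v 0) refl
                            (cong (1ℤ ℤ.*_) (interleave-odd u v 0)) refl)
                   (trans (lemma (v 0) (u 0) (+ n)) (sym v′-zero))
    where lemma : ∀ v₀ u₀ n → v₀ ℤ.+ u₀ ℤ.+ + 2 ℤ.* n ℤ.* 0ℤ ℤ.+ + 2 ℤ.* (1ℤ ℤ.* v₀) ℤ.- + 2 ℤ.* 0ℤ
                              ≡ u₀ ℤ.+ + 3 ℤ.* v₀
          lemma = ℤSolver.solve-∀
  stepH-interleave-odd (suc j) =
    trans (stepH-≡ n w (suc (suc j ℕ.* 2)) (interleave-odd u v (suc j)) (interleave-even u v (suc j))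
                   (interleave-odd u v j) (cong (+ suc (suc j ℕ.* 2) ℤ.*_) (interleave-odd u v (suc j)))
                   (trans (shift-deriv w (suc (j ℕ.* 2))) (cong (+ suc (j ℕ.* 2) ℤ.*_) (interleave-odd u v j))))
          (trans (lemma (v (suc j)) (u (suc j)) (v j) (+ n) (+ j) (ℤP.pos-* j 2)) (sym (v′-suc j)))
    where lemma : ∀ v₁ u₁ v₀ n j {j2} → j2 ≡ j ℤ.* + 2 →
                  v₁ ℤ.+ u₁ ℤ.+ + 2 ℤ.* n ℤ.* v₀ ℤ.+ + 2 ℤ.* ((+ 3 ℤ.+ j2) ℤ.* v₁) ℤ.- + 2 ℤ.* ((1ℤ ℤ.+ j2) ℤ.* v₀)
                  ≡ u₁ ℤ.+ (+ 4 ℤ.* (1ℤ ℤ.+ j) ℤ.+ + 3) ℤ.* v₁ ℤ.+ (+ 2 ℤ.* n ℤ.- + 4 ℤ.* j ℤ.- + 2) ℤ.* v₀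
          lemma v₁ u₁ v₀ n j refl = algebra v₁ u₁ v₀ n j
            where algebra : ∀ v₁ u₁ v₀ n j →
                    v₁ ℤ.+ u₁ ℤ.+ + 2 ℤ.* n ℤ.* v₀ ℤ.+ + 2 ℤ.* ((+ 3 ℤ.+ j ℤ.* + 2) ℤ.* v₁)
                    ℤ.- + 2 ℤ.* ((1ℤ ℤ.+ j ℤ.* + 2) ℤ.* v₀)
                    ≡ u₁ ℤ.+ (+ 4 ℤ.* (1ℤ ℤ.+ j) ℤ.+ + 3) ℤ.* v₁ ℤ.+ (+ 2 ℤ.* n ℤ.- + 4 ℤ.* j ℤ.- + 2) ℤ.* v₀
                  algebra = ℤSolver.solve-∀

  stepH-interleave : ∀ k → stepH n (interleave u v) k ≡ interleave u′ v′ k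
  stepH-interleave = ≗-interleave (stepH n w) u′ v′ stepH-interleave-even stepH-interleave-odd

-- Counting in lists

⌊⌋-true : ∀ {P : Set} (P? : Dec P) → P → ⌊ P? ⌋ ≡ true
⌊⌋-true P? p = trans (isYes≗does P?) (dec-true P? p)

⌊⌋-false : ∀ {P : Set} (P? : Dec P) → ¬ P → ⌊ P? ⌋ ≡ false
⌊⌋-false P? ¬p = trans (isYes≗does P?) (dec-false P? ¬p)

indicator : Bool → ℕ
indicator b = if b then 1 else 0

ι : Bool → ℤ
ι b = + indicator b

count : (A → Bool) → List A → ℕ
count g []       = 0
count g (x ∷ xs) = indicator (g x) ℕ.+ count g xs

count-++ : ∀ (g : A → Bool) xs ys → count g (xs ++ ys) ≡ count g xs ℕ.+ count g ys
count-++ g []       ys = refl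
count-++ g (x ∷ xs) ys =
  trans (cong (indicator (g x) ℕ.+_) (count-++ g xs ys)) (sym (ℕP.+-assoc (indicator (g x)) _ _))

count-map : ∀ (g : B → Bool) (f : A → B) xs → count g (map f xs) ≡ count (g ∘ f) xs
count-map g f []       = refl
count-map g f (x ∷ xs) = cong (indicator (g (f x)) ℕ.+_) (count-map g f xs)

count-cong : ∀ (g h : A → Bool) xs → (∀ {x} → x ∈ xs → g x ≡ h x) → count g xs ≡ count h xs
count-cong g h []       g≗h = refl
count-cong g h (x ∷ xs) g≗h =
  cong₂ (λ b n → indicator b ℕ.+ n) (g≗h (here refl)) (count-cong g h xs (g≗h ∘ there))

count-false : ∀ (xs : List A) → count (λ _ → false) xs ≡ 0
count-false []       = refl
count-false (x ∷ xs) = count-false xs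

count-↭ : ∀ (g : A → Bool) {xs ys} → xs ↭ ys → count g xs ≡ count g ys
count-↭ g ↭.refl          = refl
count-↭ g (↭.prep x p)    = cong (indicator (g x) ℕ.+_) (count-↭ g p)
count-↭ g (↭.swap x y p)  =
  trans (sym (ℕP.+-assoc (indicator (g x)) _ _))
        (trans (cong₂ ℕ._+_ (ℕP.+-comm (indicator (g x)) (indicator (g y))) (count-↭ g p))
               (ℕP.+-assoc (indicator (g y)) _ _))
count-↭ g (↭.trans p q)   = trans (count-↭ g p) (count-↭ g q)

unique-same-elements⇒↭ : ∀ {xs ys : List A} → Unique xs → Unique ys →
                         (∀ {x} → x ∈ xs → x ∈ ys) → (∀ {x} → x ∈ ys → x ∈ xs) → xs ↭ ys
unique-same-elements⇒↭ uxs uys xs⊆ys ys⊆xs = ∼bag⇒↭ (unique∧set⇒bag uxs uys (mk⇔ xs⊆ys ys⊆xs))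

length-filter : ∀ {P : Pred A 0ℓ} (P? : ∀ x → Dec (P x)) xs →
                length (filter P? xs) ≡ count (⌊_⌋ ∘ P?) xs
length-filter P? []       = refl
length-filter P? (x ∷ xs) with P? x
... | yes _ = cong suc (length-filter P? xs)
... | no  _ = length-filter P? xs

count-filter : ∀ {P : Pred A 0ℓ} (P? : ∀ x → Dec (P x)) (g : A → Bool) xs →
               count g (filter P? xs) ≡ count (λ x → ⌊ P? x ⌋ ∧ g x) xs
count-filter P? g []       = refl
count-filter P? g (x ∷ xs) with P? x
... | yes _ = cong (indicator (g x) ℕ.+_) (count-filter P? g xs)
... | no  _ = count-filter P? g xs

sumℤ : (A → ℤ) → List A → ℤ
sumℤ F []       = 0ℤ
sumℤ F (x ∷ xs) = F x ℤ.+ sumℤ F xs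

count-concatMap : ∀ (g : B → Bool) (f : A → List B) xs →
                  + count g (concatMap f xs) ≡ sumℤ (λ x → + count g (f x)) xs
count-concatMap g f []       = refl
count-concatMap g f (x ∷ xs) =
  trans (cong +_ (count-++ g (f x) (concatMap f xs)))
        (trans (ℤP.pos-+ (count g (f x)) _) (cong (ℤ._+_ (+ count g (f x))) (count-concatMap g f xs)))

sumℤ-cong : ∀ (F G : A → ℤ) xs → (∀ {x} → x ∈ xs → F x ≡ G x) → sumℤ F xs ≡ sumℤ G xs
sumℤ-cong F G []       F≗G = refl
sumℤ-cong F G (x ∷ xs) F≗G = cong₂ ℤ._+_ (F≗G (here refl)) (sumℤ-cong F G xs (F≗G ∘ there))

sumℤ-+ : ∀ (F G : A → ℤ) xs → sumℤ (λ x → F x ℤ.+ G x) xs ≡ sumℤ F xs ℤ.+ sumℤ G xs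
sumℤ-+ F G []       = refl
sumℤ-+ F G (x ∷ xs) = trans (cong (ℤ._+_ (F x ℤ.+ G x)) (sumℤ-+ F G xs))
                            (lemma (F x) (G x) (sumℤ F xs) (sumℤ G xs))
  where lemma : ∀ a b c d → a ℤ.+ b ℤ.+ (c ℤ.+ d) ≡ a ℤ.+ c ℤ.+ (b ℤ.+ d)
        lemma = ℤSolver.solve-∀

sumℤ-indicator : ∀ (q : A → Bool) a xs → sumℤ (λ x → ι (q x) ℤ.* a) xs ≡ a ℤ.* + count q xs
sumℤ-indicator q a []       = sym (ℤP.*-zeroʳ a)
sumℤ-indicator q a (x ∷ xs) =
  trans (cong (ℤ._+_ (ι (q x) ℤ.* a)) (sumℤ-indicator q a xs))
        (trans (lemma (ι (q x)) a (+ count q xs))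
               (cong (a ℤ.*_) (sym (ℤP.pos-+ (indicator (q x)) (count q xs)))))
  where lemma : ∀ i a c → i ℤ.* a ℤ.+ a ℤ.* c ≡ a ℤ.* (i ℤ.+ c)
        lemma = ℤSolver.solve-∀

sumℕ : (A → ℕ) → List A → ℕ
sumℕ f []       = 0
sumℕ f (x ∷ xs) = f x ℕ.+ sumℕ f xs

sumℕ-map : ∀ (f : List A → ℕ) b ws → sumℕ f (map (b ∷_) ws) ≡ sumℕ (f ∘ (b ∷_)) ws
sumℕ-map f b []       = refl
sumℕ-map f b (w ∷ ws) = cong (f (b ∷ w) ℕ.+_) (sumℕ-map f b ws)

sumℕ-+ : ∀ (f g : A → ℕ) ws → sumℕ (λ w → f w ℕ.+ g w) ws ≡ sumℕ f ws ℕ.+ sumℕ g ws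
sumℕ-+ f g []       = refl
sumℕ-+ f g (w ∷ ws) rewrite sumℕ-+ f g ws =
  lemma (f w) (g w) (sumℕ f ws) (sumℕ g ws)
  where lemma : ∀ a b c d → a ℕ.+ b ℕ.+ (c ℕ.+ d) ≡ a ℕ.+ c ℕ.+ (b ℕ.+ d)
        lemma = ℕSolver.solve-∀

sumℕ-cong : ∀ (f g : A → ℕ) ws → (∀ w → f w ≡ g w) → sumℕ f ws ≡ sumℕ g ws
sumℕ-cong f g []       f≗g = refl
sumℕ-cong f g (w ∷ ws) f≗g = cong₂ ℕ._+_ (f≗g w) (sumℕ-cong f g ws f≗g)

sumℕ-const : ∀ k (ws : List A) → sumℕ (λ _ → k) ws ≡ length ws ℕ.* k
sumℕ-const k []       = refl
sumℕ-const k (w ∷ ws) = cong (k ℕ.+_) (sumℕ-const k ws)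

-- Signed permutations built by inserting ±(n+1)

Unique-resp-↭ : {xs ys : List A} → xs ↭ ys → Unique xs → Unique ys
Unique-resp-↭ {A} xs↭ys = ↭S.Unique-resp-↭ (setoid A) (↭.↭⇒↭ₛ xs↭ys)

concatMap-unique : ∀ {B : Set} (f : A → List B) (g : B → A) xs → Unique xs →
  (∀ {x} → x ∈ xs → Unique (f x)) → (∀ {x y} → x ∈ xs → y ∈ f x → g y ≡ x) →
  Unique (concatMap f xs)
concatMap-unique f g []       _          _  _     = []
concatMap-unique f g (x ∷ xs) (x∉ ∷ uxs) uf g∘f≡ =
  UniqueP.++⁺ (uf (here refl)) (concatMap-unique f g xs uxs (uf ∘ there) (g∘f≡ ∘ there)) disjoint
  where
  disjoint : ∀ {y} → ¬ (y ∈ f x × y ∈ concatMap f xs)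
  disjoint (y∈fx , y∈rest) with find (∈-concatMap⁻ f {xs} y∈rest)
  ... | x′ , x′∈xs , y∈fx′ =
    All.lookup x∉ x′∈xs (trans (sym (g∘f≡ (here refl) y∈fx)) (g∘f≡ (there x′∈xs) y∈fx′))

insertions : A → List A → List (List A)
insertions x []      = [ x ∷ [] ]
insertions x (b ∷ v) = (x ∷ b ∷ v) ∷ map (b ∷_) (insertions x v)

length-insertions : ∀ (x : A) v → length (insertions x v) ≡ suc (length v)
length-insertions x []      = refl
length-insertions x (b ∷ v) =
  cong suc (trans (ListP.length-map (b ∷_) (insertions x v)) (length-insertions x v))

insertions-↭ : ∀ (x : A) v {w} → w ∈ insertions x v → w ↭ x ∷ v
insertions-↭ x []      (here refl) = ↭-refl
insertions-↭ x (b ∷ v) (here refl) = ↭-refl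
insertions-↭ x (b ∷ v) (there w∈) with ∈-map⁻ (b ∷_) w∈
... | w′ , w′∈ , refl = ↭-trans (↭.prep b (insertions-↭ x v w′∈)) (↭.swap b x ↭-refl)

∈-insertions : ∀ (x : A) p q → p ++ x ∷ q ∈ insertions x (p ++ q)
∈-insertions x []      []      = here refl
∈-insertions x []      (c ∷ q) = here refl
∈-insertions x (b ∷ p) q       = there (∈-map⁺ (b ∷_) (∈-insertions x p q))

insertions-unique : ∀ (x : A) v → x ∉ v → Unique (insertions x v)
insertions-unique x []      _   = [] ∷ []
insertions-unique x (b ∷ v) x∉v =
  ¬Any⇒All¬ _ head∉ ∷ UniqueP.map⁺ ListP.∷-injectiveʳ (insertions-unique x v (x∉v ∘ there))
  where
  head∉ : (x ∷ b ∷ v) ∉ map (b ∷_) (insertions x v)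
  head∉ w∈ with ∈-map⁻ (b ∷_) w∈
  ... | _ , _ , eq = x∉v (here (proj₁ (ListP.∷-injective eq)))

InRange : ℕ → ℤ → Set
InRange n x = 0 ℕ.< ℤ.∣ x ∣ × ℤ.∣ x ∣ ℕ.≤ n

IsSignedPerm : ℕ → List ℤ → Set
IsSignedPerm n w = length w ≡ n × All (InRange n) w × Unique (map ℤ.∣_∣ w)

insertExtremes : ℕ → List ℤ → List (List ℤ)
insertExtremes n v = insertions (+ suc n) v ++ insertions -[1+ n ] v

signedPermsByInsertion : ℕ → List (List ℤ)
signedPermsByInsertion zero    = [ [] ]
signedPermsByInsertion (suc n) = concatMap (insertExtremes n) (signedPermsByInsertion n)

InRange-suc-∉ : ∀ n x {v} → ℤ.∣ x ∣ ≡ suc n → All (InRange n) v → ℤ.∣ x ∣ ∉ map ℤ.∣_∣ v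
InRange-suc-∉ n x ∣x∣≡ inRange ∣x∣∈ with ∈-map⁻ ℤ.∣_∣ ∣x∣∈
... | y , y∈v , ∣x∣≡∣y∣ =
  ℕP.1+n≰n (subst (ℕ._≤ n) (trans (sym ∣x∣≡∣y∣) ∣x∣≡) (proj₂ (All.lookup inRange y∈v)))

insertion-isSignedPerm : ∀ n x v {w} → IsSignedPerm n v → ℤ.∣ x ∣ ≡ suc n →
                         w ∈ insertions x v → IsSignedPerm (suc n) w
insertion-isSignedPerm n x v {w} (len , inRange , unique) ∣x∣≡ w∈ =
  trans (↭P.↭-length w↭) (cong suc len) ,
  ↭P.All-resp-↭ (↭-sym w↭) ((subst (0 ℕ.<_) (sym ∣x∣≡) (s≤s z≤n) , ℕP.≤-reflexive ∣x∣≡)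
                            ∷ All.map (λ (p , q) → p , ℕP.m≤n⇒m≤1+n q) inRange) ,
  Unique-resp-↭ (↭P.map⁺ ℤ.∣_∣ (↭-sym w↭)) (¬Any⇒All¬ _ (InRange-suc-∉ n x ∣x∣≡ inRange) ∷ unique)
  where
  w↭ : w ↭ x ∷ v
  w↭ = insertions-↭ x v w∈

byInsertion⇒isSignedPerm : ∀ n {w} → w ∈ signedPermsByInsertion n → IsSignedPerm n w
byInsertion⇒isSignedPerm zero    (here refl) = refl , [] , []
byInsertion⇒isSignedPerm (suc n) w∈
  with find (∈-concatMap⁻ (insertExtremes n) {signedPermsByInsertion n} w∈)
... | v , v∈ , w∈ext with ∈-++⁻ (insertions (+ suc n) v) w∈ext
...   | inj₁ w∈⁺ = insertion-isSignedPerm n _ v (byInsertion⇒isSignedPerm n v∈) refl w∈⁺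
...   | inj₂ w∈⁻ = insertion-isSignedPerm n _ v (byInsertion⇒isSignedPerm n v∈) refl w∈⁻

unique-inRange⇒length≤ : ∀ n (u : List ℕ) → Unique u → All (λ y → 0 ℕ.< y × y ℕ.≤ n) u →
                         length u ℕ.≤ n
unique-inRange⇒length≤ zero    []                _ _ = z≤n
unique-inRange⇒length≤ zero    (y ∷ u)           _ ((0<y , y≤0) ∷ _) =
  ⊥-elim (ℕP.<-irrefl refl (ℕP.<-≤-trans 0<y y≤0))
unique-inRange⇒length≤ (suc n) u uu inRange with Any.any? (suc n ℕ.≟_) u
... | no  n+1∉u = ℕP.m≤n⇒m≤1+n (unique-inRange⇒length≤ n u uu (lower inRange (¬Any⇒All¬ u n+1∉u)))
  where
  lower : ∀ {u} → All (λ y → 0 ℕ.< y × y ℕ.≤ suc n) u → All (λ y → suc n ≢ y) u →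
          All (λ y → 0 ℕ.< y × y ℕ.≤ n) u
  lower p q = All.zipWith (λ ((0<y , y≤) , ≢) → 0<y , ℕP.≤-pred (ℕP.≤∧≢⇒< y≤ (≢ ∘ sym))) (p , q)
... | yes n+1∈u with ∈-∃++ n+1∈u
...   | p , q , refl = subst (ℕ._≤ suc n) (sym (↭P.↭-length σ)) (s≤s rest)
  where
  σ : p ++ suc n ∷ q ↭ suc n ∷ (p ++ q)
  σ = ↭P.shift (suc n) p q
  rest : length (p ++ q) ℕ.≤ n
  rest with Unique-resp-↭ σ uu | ↭P.All-resp-↭ σ inRange
  ... | n+1∉ ∷ upq | _ ∷ inRange′ =
    unique-inRange⇒length≤ n (p ++ q) upq
      (All.zipWith (λ ((a , b) , ≢) → a , ℕP.≤-pred (ℕP.≤∧≢⇒< b (≢ ∘ sym))) (inRange′ , n+1∉))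

∣x∣≡1+n⇒x≡± : ∀ x n → ℤ.∣ x ∣ ≡ suc n → x ≡ + suc n ⊎ x ≡ -[1+ n ]
∣x∣≡1+n⇒x≡± (+ _)      n refl = inj₁ refl
∣x∣≡1+n⇒x≡± -[1+ _ ]   n refl = inj₂ refl

isSignedPerm⇒byInsertion : ∀ n w → IsSignedPerm n w → w ∈ signedPermsByInsertion n
isSignedPerm⇒byInsertion zero    []  _                          = here refl
isSignedPerm⇒byInsertion (suc n) w (len , inRange , unique)
  with Any.any? (λ x → ℤ.∣ x ∣ ℕ.≟ suc n) w
... | no n+1∉ = ⊥-elim (ℕP.1+n≰n (subst (ℕ._≤ n) (trans (ListP.length-map ℤ.∣_∣ w) len)
                  (unique-inRange⇒length≤ n (map ℤ.∣_∣ w) unique (AllP.map⁺ inRange′))))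
  where
  inRange′ : All (InRange n) w
  inRange′ = All.zipWith (λ ((a , b) , ≢) → a , ℕP.≤-pred (ℕP.≤∧≢⇒< b ≢)) (inRange , ¬Any⇒All¬ w n+1∉)
... | yes n+1∈ with find n+1∈
...   | x , x∈w , ∣x∣≡ with ∈-∃++ x∈w
...     | p , q , refl =
  ∈-concatMap⁺ (insertExtremes n) {signedPermsByInsertion n} (lose v∈ w∈ext)
  where
  v : List ℤ
  v = p ++ q
  σ : p ++ x ∷ q ↭ x ∷ v
  σ = ↭P.shift x p q
  v∈ : v ∈ signedPermsByInsertion n
  v∈ with Unique-resp-↭ (↭P.map⁺ ℤ.∣_∣ σ) unique | ↭P.All-resp-↭ σ inRange
  ... | ∣x∣∉ ∷ uv | _ ∷ inRange-v = isSignedPerm⇒byInsertion n v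
    ( ℕP.suc-injective (trans (sym (↭P.↭-length σ)) len)
    , All.zipWith (λ ((a , b) , ≢) → a , ℕP.≤-pred (ℕP.≤∧≢⇒< b (λ eq → ≢ (trans ∣x∣≡ (sym eq)))))
                  (inRange-v , AllP.map⁻ ∣x∣∉)
    , uv )
  w∈ext : p ++ x ∷ q ∈ insertExtremes n v
  w∈ext with ∣x∣≡1+n⇒x≡± x n ∣x∣≡
  ... | inj₁ refl = ∈-++⁺ˡ (∈-insertions (+ suc n) p q)
  ... | inj₂ refl = ∈-++⁺ʳ (insertions (+ suc n) v) (∈-insertions -[1+ n ] p q)

removeAbs : ℕ → List ℤ → List ℤ
removeAbs m []      = []
removeAbs m (y ∷ w) = if ⌊ ℤ.∣ y ∣ ℕ.≟ m ⌋ then removeAbs m w else y ∷ removeAbs m w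

removeAbs-absent : ∀ m v → All (λ y → ℤ.∣ y ∣ ≢ m) v → removeAbs m v ≡ v
removeAbs-absent m []      _          = refl
removeAbs-absent m (y ∷ v) (≢ ∷ rest) with ℤ.∣ y ∣ ℕ.≟ m
... | yes eq = ⊥-elim (≢ eq)
... | no  _  = cong (y ∷_) (removeAbs-absent m v rest)

removeAbs-∷ : ∀ m x v → ℤ.∣ x ∣ ≡ m → All (λ y → ℤ.∣ y ∣ ≢ m) v → removeAbs m (x ∷ v) ≡ v
removeAbs-∷ m x v ∣x∣≡ absent with ℤ.∣ x ∣ ℕ.≟ m
... | yes _ = removeAbs-absent m v absent
... | no ≢  = ⊥-elim (≢ ∣x∣≡)

removeAbs-insertions : ∀ m x v {w} → ℤ.∣ x ∣ ≡ m → All (λ y → ℤ.∣ y ∣ ≢ m) v →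
                       w ∈ insertions x v → removeAbs m w ≡ v
removeAbs-insertions m x []      ∣x∣≡ absent (here refl) = removeAbs-∷ m x [] ∣x∣≡ absent
removeAbs-insertions m x (b ∷ v) ∣x∣≡ absent (here refl) = removeAbs-∷ m x (b ∷ v) ∣x∣≡ absent
removeAbs-insertions m x (b ∷ v) ∣x∣≡ (≢ ∷ absent) (there w∈) with ∈-map⁻ (b ∷_) w∈
... | w′ , w′∈ , refl with ℤ.∣ b ∣ ℕ.≟ m
...   | yes eq = ⊥-elim (≢ eq)
...   | no  _  = cong (b ∷_) (removeAbs-insertions m x v ∣x∣≡ absent w′∈)

byInsertion-unique : ∀ n → Unique (signedPermsByInsertion n)
byInsertion-unique zero    = [] ∷ []
byInsertion-unique (suc n) =
  concatMap-unique (insertExtremes n) (removeAbs (suc n)) (signedPermsByInsertion n)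
                   (byInsertion-unique n) unique-extremes removeAbs-extremes
  where
  inRange : ∀ {v} → v ∈ signedPermsByInsertion n → All (InRange n) v
  inRange = proj₁ ∘ proj₂ ∘ byInsertion⇒isSignedPerm n
  absentAbs : ∀ {v} → v ∈ signedPermsByInsertion n → All (λ y → ℤ.∣ y ∣ ≢ suc n) v
  absentAbs v∈ = All.map (λ (_ , ≤n) eq → ℕP.1+n≰n (subst (ℕ._≤ n) eq ≤n)) (inRange v∈)
  absent : ∀ x {v} → ℤ.∣ x ∣ ≡ suc n → v ∈ signedPermsByInsertion n → x ∉ v
  absent x ∣x∣≡ v∈ x∈v = All.lookup (absentAbs v∈) x∈v ∣x∣≡
  unique-extremes : ∀ {v} → v ∈ signedPermsByInsertion n → Unique (insertExtremes n v)
  unique-extremes {v} v∈ =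
    UniqueP.++⁺ (insertions-unique _ v (absent _ refl v∈)) (insertions-unique _ v (absent _ refl v∈)) disjoint
    where
    disjoint : ∀ {w} → ¬ (w ∈ insertions (+ suc n) v × w ∈ insertions -[1+ n ] v)
    disjoint (w∈⁺ , w∈⁻)
      with ↭P.∈-resp-↭ (insertions-↭ -[1+ n ] v w∈⁻)
                       (↭P.∈-resp-↭ (↭-sym (insertions-↭ (+ suc n) v w∈⁺)) (here refl))
    ... | there n+1∈v = absent _ refl v∈ n+1∈v
  removeAbs-extremes : ∀ {v w} → v ∈ signedPermsByInsertion n → w ∈ insertExtremes n v →
                       removeAbs (suc n) w ≡ v
  removeAbs-extremes {v} v∈ w∈ with ∈-++⁻ (insertions (+ suc n) v) w∈
  ... | inj₁ w∈⁺ = removeAbs-insertions (suc n) _ v refl (absentAbs v∈) w∈⁺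
  ... | inj₂ w∈⁻ = removeAbs-insertions (suc n) _ v refl (absentAbs v∈) w∈⁻

∈-±⇒InRange : ∀ n {x} → x ∈ ±[ n ] → InRange n x
∈-±⇒InRange n x∈ with ∈-++⁻ (applyUpTo (λ i → ℤ.- (+ suc i)) n) x∈
... | inj₁ x∈⁻ with ∈-applyUpTo⁻ (λ i → ℤ.- (+ suc i)) x∈⁻
...   | i , i<n , refl = s≤s z≤n , i<n
∈-±⇒InRange n x∈ | inj₂ x∈⁺ with ∈-applyUpTo⁻ (λ i → + suc i) x∈⁺
...   | i , i<n , refl = s≤s z≤n , i<n

InRange⇒∈-± : ∀ n x → InRange n x → x ∈ ±[ n ]
InRange⇒∈-± n (+ suc i)  (_ , i<n) =
  ∈-++⁺ʳ (applyUpTo (λ i → ℤ.- (+ suc i)) n) (∈-applyUpTo⁺ (λ i → + suc i) i<n)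
InRange⇒∈-± n -[1+ i ]   (_ , i<n) = ∈-++⁺ˡ (∈-applyUpTo⁺ (λ i → ℤ.- (+ suc i)) i<n)

±-unique : ∀ n → Unique ±[ n ]
±-unique n = UniqueP.++⁺
  (UniqueP.applyUpTo⁺₁ _ n (λ i<j _ eq → ℕP.<⇒≢ i<j (ℕP.suc-injective (ℤP.+-injective (ℤP.neg-injective eq)))))
  (UniqueP.applyUpTo⁺₁ _ n (λ i<j _ eq → ℕP.<⇒≢ i<j (ℕP.suc-injective (ℤP.+-injective eq))))
  disjoint
  where
  disjoint : ∀ {x} → ¬ (x ∈ applyUpTo (λ i → ℤ.- (+ suc i)) n × x ∈ applyUpTo (λ i → + suc i) n)
  disjoint (x∈⁻ , x∈⁺) with ∈-applyUpTo⁻ (λ i → ℤ.- (+ suc i)) x∈⁻ | ∈-applyUpTo⁻ (λ i → + suc i) x∈⁺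
  ... | _ , _ , refl | _ , _ , ()

∈-words⁻ : ∀ (xs : List A) n {w} → w ∈ words xs n → length w ≡ n × All (_∈ xs) w
∈-words⁻ xs zero    (here refl) = refl , []
∈-words⁻ xs (suc n) w∈ with find (∈-concatMap⁻ (λ x → map (x ∷_) (words xs n)) {xs} w∈)
... | x , x∈xs , w∈ₓ with ∈-map⁻ (x ∷_) w∈ₓ
...   | w′ , w′∈ , refl with ∈-words⁻ xs n w′∈
...     | len , all∈ = cong suc len , x∈xs ∷ all∈

∈-words⁺ : ∀ (xs : List A) n w → length w ≡ n → All (_∈ xs) w → w ∈ words xs n
∈-words⁺ xs zero    []      _   _              = here refl
∈-words⁺ xs (suc n) (x ∷ w) len (x∈xs ∷ all∈) =
  ∈-concatMap⁺ (λ x → map (x ∷_) (words xs n)) {xs}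
    (lose x∈xs (∈-map⁺ (x ∷_) (∈-words⁺ xs n w (ℕP.suc-injective len) all∈)))

words-unique : ∀ (xs : List ℤ) n → Unique xs → Unique (words xs n)
words-unique xs zero    _   = [] ∷ []
words-unique xs (suc n) uxs = concatMap-unique (λ x → map (x ∷_) (words xs n)) head xs uxs
  (λ _ → UniqueP.map⁺ ListP.∷-injectiveʳ (words-unique xs n uxs)) head-∷
  where
  head : List ℤ → ℤ
  head (x ∷ _) = x
  head []      = 0ℤ
  head-∷ : ∀ {x w} → x ∈ xs → w ∈ map (x ∷_) (words xs n) → head w ≡ x
  head-∷ _ w∈ with ∈-map⁻ _ w∈
  ... | _ , _ , refl = refl

∈-signedPerms⁻ : ∀ n {w} → w ∈ signedPerms n → IsSignedPerm n w
∈-signedPerms⁻ n w∈ with ∈-filter⁻ (λ w → Data.Bool._≟_ (isSignedPerm w) true) w∈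
... | w∈words , isPerm with ∈-words⁻ ±[ n ] n w∈words
...   | len , all∈ = len , All.map (∈-±⇒InRange n) all∈ , toWitness (Equivalence.from BoolP.T-≡ isPerm)

∈-signedPerms⁺ : ∀ n w → IsSignedPerm n w → w ∈ signedPerms n
∈-signedPerms⁺ n w (len , inRange , unique) =
  ∈-filter⁺ (λ w → Data.Bool._≟_ (isSignedPerm w) true)
            (∈-words⁺ ±[ n ] n w len (All.map (InRange⇒∈-± n _) inRange))
            (⌊⌋-true (unique? (map ℤ.∣_∣ w)) unique)

signedPerms↭byInsertion : ∀ n → signedPerms n ↭ signedPermsByInsertion n
signedPerms↭byInsertion n = unique-same-elements⇒↭
  (UniqueP.filter⁺ (λ w → Data.Bool._≟_ (isSignedPerm w) true) (words-unique ±[ n ] n (±-unique n)))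
  (byInsertion-unique n)
  (λ w∈ → isSignedPerm⇒byInsertion n _ (∈-signedPerms⁻ n w∈))
  (λ w∈ → ∈-signedPerms⁺ n _ (byInsertion⇒isSignedPerm n w∈))

-- Peaks after inserting an extreme letter

peakAt : ℤ → ℤ → ℤ → ℕ
peakAt a b c = if ⌊ a ℤ.<? b ⌋ ∧ ⌊ c ℤ.<? b ⌋ then 1 else 0

headPeak : ℤ → ℤ → List ℤ → ℕ
headPeak a b []      = 0
headPeak a b (c ∷ _) = peakAt a b c

peaksL-∷∷ : ∀ a b r → peaksL (a ∷ b ∷ r) ≡ headPeak a b r ℕ.+ peaksL (b ∷ r)
peaksL-∷∷ a b []      = refl
peaksL-∷∷ a b (c ∷ r) = refl

peakAt-≮ˡ : ∀ {a b} c → ¬ a ℤ.< b → peakAt a b c ≡ 0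
peakAt-≮ˡ {a} {b} c a≮b rewrite ⌊⌋-false (a ℤ.<? b) a≮b = refl

peakAt-≮ʳ : ∀ a {b c} → ¬ c ℤ.< b → peakAt a b c ≡ 0
peakAt-≮ʳ a {b} {c} c≮b rewrite ⌊⌋-false (c ℤ.<? b) c≮b with ⌊ a ℤ.<? b ⌋
... | true  = refl
... | false = refl

peakAt-< : ∀ {a b c} → a ℤ.< b → c ℤ.< b → peakAt a b c ≡ 1
peakAt-< {a} {b} {c} a<b c<b rewrite ⌊⌋-true (a ℤ.<? b) a<b | ⌊⌋-true (c ℤ.<? b) c<b = refl

OrSuc : ℕ → ℕ → Set
OrSuc P x = x ≡ P ⊎ x ≡ suc P

Bit : ℕ → Set
Bit e = e ≡ 0 ⊎ e ≡ 1

indicator-bit : ∀ b → Bit (indicator b)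
indicator-bit true  = inj₂ refl
indicator-bit false = inj₁ refl

peakAt-bit : ∀ a b c → Bit (peakAt a b c)
peakAt-bit a b c = indicator-bit (⌊ a ℤ.<? b ⌋ ∧ ⌊ c ℤ.<? b ⌋)

headPeak-bit : ∀ a b r → Bit (headPeak a b r)
headPeak-bit a b []      = inj₁ refl
headPeak-bit a b (c ∷ r) = peakAt-bit a b c

headPeak-≮ˡ : ∀ {a b} r → ¬ a ℤ.< b → headPeak a b r ≡ 0
headPeak-≮ˡ []      a≮b = refl
headPeak-≮ˡ (c ∷ r) a≮b = peakAt-≮ˡ c a≮b

bit-OrSuc : ∀ {e} P → Bit e → OrSuc P (e ℕ.+ P)
bit-OrSuc P (inj₁ refl) = inj₁ refl
bit-OrSuc P (inj₂ refl) = inj₂ refl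

bit-OrSuc′ : ∀ {e} P → Bit e → OrSuc (e ℕ.+ P) (suc P)
bit-OrSuc′ P (inj₁ refl) = inj₂ refl
bit-OrSuc′ P (inj₂ refl) = inj₁ refl

OrSuc-+ : ∀ e {P x} → OrSuc P x → OrSuc (e ℕ.+ P) (e ℕ.+ x)
OrSuc-+ e     (inj₁ refl) = inj₁ refl
OrSuc-+ e {P} (inj₂ refl) = inj₂ (ℕP.+-suc e P)

peakSum : ℤ → ℤ → List ℤ → ℕ
peakSum x a v = sumℕ (λ w → peaksL (a ∷ w)) (insertions x v)

peakSum-∷ : ∀ x a b v → peakSum x a (b ∷ v)
            ≡ peaksL (a ∷ x ∷ b ∷ v) ℕ.+ (peakAt a b x ℕ.+ length v ℕ.* headPeak a b v ℕ.+ peakSum x b v)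
peakSum-∷ x a b v = cong (peaksL (a ∷ x ∷ b ∷ v) ℕ.+_) (begin
    sumℕ (λ w → peaksL (a ∷ w)) (map (b ∷_) (insertions x v))
  ≡⟨ sumℕ-map (λ w → peaksL (a ∷ w)) b (insertions x v) ⟩
    sumℕ (λ w → peaksL (a ∷ b ∷ w)) (insertions x v)
  ≡⟨ sumℕ-cong _ _ (insertions x v) (peaksL-∷∷ a b) ⟩
    sumℕ (λ w → headPeak a b w ℕ.+ peaksL (b ∷ w)) (insertions x v)
  ≡⟨ sumℕ-+ (headPeak a b) _ (insertions x v) ⟩
    sumℕ (headPeak a b) (insertions x v) ℕ.+ peakSum x b v
  ≡⟨ cong (ℕ._+ peakSum x b v) (headPeak-sum v) ⟩
    peakAt a b x ℕ.+ length v ℕ.* headPeak a b v ℕ.+ peakSum x b v ∎)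
  where
  open ≡-Reasoning
  headPeak-sum : ∀ v → sumℕ (headPeak a b) (insertions x v) ≡ peakAt a b x ℕ.+ length v ℕ.* headPeak a b v
  headPeak-sum []      = refl
  headPeak-sum (c ∷ v) = cong (peakAt a b x ℕ.+_) (begin
      sumℕ (headPeak a b) (map (c ∷_) (insertions x v))
    ≡⟨ sumℕ-map (headPeak a b) c (insertions x v) ⟩
      sumℕ (λ _ → peakAt a b c) (insertions x v)
    ≡⟨ sumℕ-const (peakAt a b c) (insertions x v) ⟩
      length (insertions x v) ℕ.* peakAt a b c
    ≡⟨ cong (ℕ._* peakAt a b c) (length-insertions x v) ⟩
      suc (length v) ℕ.* peakAt a b c ∎)

peaksL-below : ∀ {M} b v → b ℤ.< M → peaksL (M ∷ b ∷ v) ≡ peaksL (b ∷ v)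
peaksL-below {M} b v b<M =
  trans (peaksL-∷∷ M b v) (cong (ℕ._+ peaksL (b ∷ v)) (headPeak-≮ˡ v (ℤP.<-asym b<M)))

-- Inserting a new maximum next to one of the P peaks or at the end leaves the peak
-- count unchanged, and every other slot creates a new peak.
peakSum-max : ∀ M a v → a ℤ.< M → All (ℤ._< M) v →
  peakSum M a v ℕ.+ 2 ℕ.* peaksL (a ∷ v) ≡ peaksL (a ∷ v) ℕ.* suc (length v) ℕ.+ length v
peakSum-max M a []      a<M []          = refl
peakSum-max M a (b ∷ v) a<M (b<M ∷ v<M) = begin
    peakSum M a (b ∷ v) ℕ.+ 2 ℕ.* peaksL (a ∷ b ∷ v)
  ≡⟨ cong₂ (λ s p → s ℕ.+ 2 ℕ.* p) (peakSum-∷ M a b v) (peaksL-∷∷ a b v) ⟩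
    peakAt a M b ℕ.+ peaksL (M ∷ b ∷ v) ℕ.+ (peakAt a b M ℕ.+ n ℕ.* e ℕ.+ S) ℕ.+ 2 ℕ.* (e ℕ.+ P)
  ≡⟨ cong₂ (λ x y → x ℕ.+ y ℕ.+ (peakAt a b M ℕ.+ n ℕ.* e ℕ.+ S) ℕ.+ 2 ℕ.* (e ℕ.+ P))
           (peakAt-< a<M b<M) (peaksL-below b v b<M) ⟩
    1 ℕ.+ P ℕ.+ (peakAt a b M ℕ.+ n ℕ.* e ℕ.+ S) ℕ.+ 2 ℕ.* (e ℕ.+ P)
  ≡⟨ cong (λ x → 1 ℕ.+ P ℕ.+ (x ℕ.+ n ℕ.* e ℕ.+ S) ℕ.+ 2 ℕ.* (e ℕ.+ P))
          (peakAt-≮ʳ a (ℤP.<-asym b<M)) ⟩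
    1 ℕ.+ P ℕ.+ (n ℕ.* e ℕ.+ S) ℕ.+ 2 ℕ.* (e ℕ.+ P)
  ≡⟨ lemma e P n S (peakSum-max M b v b<M v<M) ⟩
    (e ℕ.+ P) ℕ.* suc (suc n) ℕ.+ suc n
  ≡⟨ cong (λ p → p ℕ.* suc (suc n) ℕ.+ suc n) (sym (peaksL-∷∷ a b v)) ⟩
    peaksL (a ∷ b ∷ v) ℕ.* suc (length (b ∷ v)) ℕ.+ length (b ∷ v) ∎
  where
  open ≡-Reasoning
  e P n S : ℕ
  e = headPeak a b v
  P = peaksL (b ∷ v)
  n = length v
  S = peakSum M b v
  lemma : ∀ e P n S → S ℕ.+ 2 ℕ.* P ≡ P ℕ.* suc n ℕ.+ n →
          1 ℕ.+ P ℕ.+ (n ℕ.* e ℕ.+ S) ℕ.+ 2 ℕ.* (e ℕ.+ P) ≡ (e ℕ.+ P) ℕ.* suc (suc n) ℕ.+ suc n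
  lemma e P n S ih = trans (regroup e P n S) (trans (cong (ℕ._+ (1 ℕ.+ P ℕ.+ n ℕ.* e ℕ.+ 2 ℕ.* e)) ih)
                                                   (collect e P n))
    where
    regroup : ∀ e P n S → 1 ℕ.+ P ℕ.+ (n ℕ.* e ℕ.+ S) ℕ.+ 2 ℕ.* (e ℕ.+ P)
                          ≡ (S ℕ.+ 2 ℕ.* P) ℕ.+ (1 ℕ.+ P ℕ.+ n ℕ.* e ℕ.+ 2 ℕ.* e)
    regroup = ℕSolver.solve-∀
    collect : ∀ e P n → P ℕ.* suc n ℕ.+ n ℕ.+ (1 ℕ.+ P ℕ.+ n ℕ.* e ℕ.+ 2 ℕ.* e)
                        ≡ (e ℕ.+ P) ℕ.* suc (suc n) ℕ.+ suc n
    collect = ℕSolver.solve-∀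

insertions-max-OrSuc : ∀ M a v → a ℤ.< M → All (ℤ._< M) v →
                       All (λ w → OrSuc (peaksL (a ∷ v)) (peaksL (a ∷ w))) (insertions M v)
insertions-max-OrSuc M a []      a<M []          = inj₁ refl ∷ []
insertions-max-OrSuc M a (b ∷ v) a<M (b<M ∷ v<M) =
  front ∷ AllP.map⁺ (rest v v<M (insertions-max-OrSuc M b v b<M v<M))
  where
  front : OrSuc (peaksL (a ∷ b ∷ v)) (peaksL (a ∷ M ∷ b ∷ v))
  front rewrite peaksL-∷∷ a b v | peakAt-< a<M b<M | peaksL-below b v b<M =
    bit-OrSuc′ (peaksL (b ∷ v)) (headPeak-bit a b v)
  rest : ∀ v → All (ℤ._< M) v → All (λ w → OrSuc (peaksL (b ∷ v)) (peaksL (b ∷ w))) (insertions M v) →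
         All (λ w → OrSuc (peaksL (a ∷ b ∷ v)) (peaksL (a ∷ b ∷ w))) (insertions M v)
  rest []      _           _  = inj₁ (trans (ℕP.+-identityʳ (peakAt a b M)) (peakAt-≮ʳ a (ℤP.<-asym b<M))) ∷ []
  rest (c ∷ v) (c<M ∷ v<M) ih =
    first ∷ AllP.map⁺ (All.map (OrSuc-+ (peakAt a b c)) (AllP.map⁻ (All.tail ih)))
    where
    first : OrSuc (peaksL (a ∷ b ∷ c ∷ v)) (peaksL (a ∷ b ∷ M ∷ c ∷ v))
    first = by-cases (c ℤ.<? b)
      where
      by-cases : Dec (c ℤ.< b) → OrSuc (peaksL (a ∷ b ∷ c ∷ v)) (peaksL (a ∷ b ∷ M ∷ c ∷ v))
      by-cases (yes c<b) rewrite peakAt-≮ʳ a (ℤP.<-asym b<M) | peakAt-< b<M c<M | peaksL-below c v c<M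
                               | peaksL-∷∷ b c v | headPeak-≮ˡ v (ℤP.<-asym c<b)
        = bit-OrSuc′ (peaksL (c ∷ v)) (peakAt-bit a b c)
      by-cases (no c≮b) rewrite peakAt-≮ʳ a (ℤP.<-asym b<M) | peakAt-< b<M c<M | peaksL-below c v c<M
                              | peaksL-∷∷ b c v | peakAt-≮ʳ a c≮b
        = bit-OrSuc′ (peaksL (c ∷ v)) (headPeak-bit b c v)

peaksL-max-front : ∀ {M a b} v → a ℤ.< M → b ℤ.< M → ¬ a ℤ.< b →
                   peaksL (a ∷ M ∷ b ∷ v) ≡ suc (peaksL (a ∷ b ∷ v))
peaksL-max-front {M} {a} {b} v a<M b<M a≮b
  rewrite peaksL-∷∷ a b v | peakAt-< a<M b<M | peaksL-below b v b<M | headPeak-≮ˡ v a≮b = refl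

less : ℤ → ℤ → ℕ
less a b = indicator ⌊ a ℤ.<? b ⌋

headBelow : ℤ → List ℤ → ℕ
headBelow a []      = 0
headBelow a (b ∷ _) = less b a

less-+-less : ∀ {a b} → a ≢ b → less a b ℕ.+ less b a ≡ 1
less-+-less {a} {b} a≢b with ℤP.<-cmp a b
... | tri< a<b _ _ rewrite ⌊⌋-true (a ℤ.<? b) a<b | ⌊⌋-false (b ℤ.<? a) (ℤP.<-asym a<b) = refl
... | tri≈ _ a≡b _ = ⊥-elim (a≢b a≡b)
... | tri> _ _ b<a rewrite ⌊⌋-true (b ℤ.<? a) b<a | ⌊⌋-false (a ℤ.<? b) (ℤP.<-asym b<a) = refl

headBelow-bit : ∀ a v → Bit (headBelow a v)
headBelow-bit a []      = inj₁ refl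
headBelow-bit a (b ∷ v) = indicator-bit ⌊ b ℤ.<? a ⌋

peakAt-min : ∀ {m} a b → m ℤ.< b → peakAt a b m ≡ less a b
peakAt-min {m} a b m<b rewrite ⌊⌋-true (m ℤ.<? b) m<b with ⌊ a ℤ.<? b ⌋
... | true  = refl
... | false = refl

headPeak-< : ∀ {a b} v → a ℤ.< b → headPeak a b v ≡ headBelow b v
headPeak-< []      a<b = refl
headPeak-< {a} {b} (c ∷ v) a<b rewrite ⌊⌋-true (a ℤ.<? b) a<b = refl

peaksL-min : ∀ {m} b v → m ℤ.< b → peaksL (m ∷ b ∷ v) ≡ headBelow b v ℕ.+ peaksL (b ∷ v)
peaksL-min b v m<b = trans (peaksL-∷∷ _ b v) (cong (ℕ._+ peaksL (b ∷ v)) (headPeak-< v m<b))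

peakSum-min : ∀ m a v → m ℤ.< a → All (m ℤ.<_) v → Linked _≢_ (a ∷ v) →
  peakSum m a v ℕ.+ 2 ℕ.* peaksL (a ∷ v) ℕ.+ headBelow a v ≡ peaksL (a ∷ v) ℕ.* suc (length v) ℕ.+ length v
peakSum-min m a []      m<a []          _              = refl
peakSum-min m a (b ∷ v) m<a (m<b ∷ m<v) (a≢b ∷ linked) = begin
    peakSum m a (b ∷ v) ℕ.+ 2 ℕ.* peaksL (a ∷ b ∷ v) ℕ.+ less b a
  ≡⟨ cong₂ (λ s p → s ℕ.+ 2 ℕ.* p ℕ.+ less b a) (peakSum-∷ m a b v) (peaksL-∷∷ a b v) ⟩
    peakAt a m b ℕ.+ peaksL (m ∷ b ∷ v) ℕ.+ (peakAt a b m ℕ.+ n ℕ.* e ℕ.+ S) ℕ.+ 2 ℕ.* (e ℕ.+ P) ℕ.+ less b a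
  ≡⟨ cong₂ (λ x y → x ℕ.+ y ℕ.+ (peakAt a b m ℕ.+ n ℕ.* e ℕ.+ S) ℕ.+ 2 ℕ.* (e ℕ.+ P) ℕ.+ less b a)
           (peakAt-≮ˡ b (ℤP.<-asym m<a)) (peaksL-min b v m<b) ⟩
    0 ℕ.+ (d ℕ.+ P) ℕ.+ (peakAt a b m ℕ.+ n ℕ.* e ℕ.+ S) ℕ.+ 2 ℕ.* (e ℕ.+ P) ℕ.+ less b a
  ≡⟨ cong (λ x → 0 ℕ.+ (d ℕ.+ P) ℕ.+ (x ℕ.+ n ℕ.* e ℕ.+ S) ℕ.+ 2 ℕ.* (e ℕ.+ P) ℕ.+ less b a)
          (peakAt-min a b m<b) ⟩
    0 ℕ.+ (d ℕ.+ P) ℕ.+ (less a b ℕ.+ n ℕ.* e ℕ.+ S) ℕ.+ 2 ℕ.* (e ℕ.+ P) ℕ.+ less b a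
  ≡⟨ lemma e P n S d (less a b) (less b a) (less-+-less a≢b) (peakSum-min m b v m<b m<v linked) ⟩
    (e ℕ.+ P) ℕ.* suc (suc n) ℕ.+ suc n
  ≡⟨ cong (λ p → p ℕ.* suc (suc n) ℕ.+ suc n) (sym (peaksL-∷∷ a b v)) ⟩
    peaksL (a ∷ b ∷ v) ℕ.* suc (length (b ∷ v)) ℕ.+ length (b ∷ v) ∎
  where
  open ≡-Reasoning
  e P n S d : ℕ
  e = headPeak a b v
  P = peaksL (b ∷ v)
  n = length v
  S = peakSum m b v
  d = headBelow b v
  lemma : ∀ e P n S d x y → x ℕ.+ y ≡ 1 → S ℕ.+ 2 ℕ.* P ℕ.+ d ≡ P ℕ.* suc n ℕ.+ n →
          0 ℕ.+ (d ℕ.+ P) ℕ.+ (x ℕ.+ n ℕ.* e ℕ.+ S) ℕ.+ 2 ℕ.* (e ℕ.+ P) ℕ.+ y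
          ≡ (e ℕ.+ P) ℕ.* suc (suc n) ℕ.+ suc n
  lemma e P n S d x y x+y≡1 ih =
    trans (regroup e P n S d x y)
          (trans (cong₂ (λ u v → u ℕ.+ P ℕ.+ n ℕ.* e ℕ.+ 2 ℕ.* e ℕ.+ v) ih x+y≡1) (collect e P n))
    where
    regroup : ∀ e P n S d x y → 0 ℕ.+ (d ℕ.+ P) ℕ.+ (x ℕ.+ n ℕ.* e ℕ.+ S) ℕ.+ 2 ℕ.* (e ℕ.+ P) ℕ.+ y
              ≡ (S ℕ.+ 2 ℕ.* P ℕ.+ d) ℕ.+ P ℕ.+ n ℕ.* e ℕ.+ 2 ℕ.* e ℕ.+ (x ℕ.+ y)
    regroup = ℕSolver.solve-∀
    collect : ∀ e P n → P ℕ.* suc n ℕ.+ n ℕ.+ P ℕ.+ n ℕ.* e ℕ.+ 2 ℕ.* e ℕ.+ 1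
              ≡ (e ℕ.+ P) ℕ.* suc (suc n) ℕ.+ suc n
    collect = ℕSolver.solve-∀

≮∧≢⇒> : ∀ {a b} → ¬ b ℤ.< a → a ≢ b → a ℤ.< b
≮∧≢⇒> b≮a a≢b = ℤP.≤∧≢⇒< (ℤP.≮⇒≥ b≮a) a≢b

insertions-min-OrSuc : ∀ m a v → m ℤ.< a → All (m ℤ.<_) v → Linked _≢_ (a ∷ v) →
                       All (λ w → OrSuc (peaksL (a ∷ v)) (peaksL (a ∷ w))) (insertions m v)
insertions-min-OrSuc m a []      m<a []          _              = inj₁ refl ∷ []
insertions-min-OrSuc m a (b ∷ v) m<a (m<b ∷ m<v) (a≢b ∷ linked) =
  front (a ℤ.<? b) ∷ AllP.map⁺ (rest v m<v linked (insertions-min-OrSuc m b v m<b m<v linked))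
  where
  front : Dec (a ℤ.< b) → OrSuc (peaksL (a ∷ b ∷ v)) (peaksL (a ∷ m ∷ b ∷ v))
  front (yes a<b) rewrite peaksL-∷∷ a b v | peakAt-≮ˡ {a} {m} b (ℤP.<-asym m<a) | peaksL-min b v m<b
                        | headPeak-< v a<b = inj₁ refl
  front (no a≮b)  rewrite peaksL-∷∷ a b v | peakAt-≮ˡ {a} {m} b (ℤP.<-asym m<a) | peaksL-min b v m<b
                        | headPeak-≮ˡ v a≮b = bit-OrSuc (peaksL (b ∷ v)) (headBelow-bit b v)
  rest : ∀ v → All (m ℤ.<_) v → Linked _≢_ (b ∷ v) →
         All (λ w → OrSuc (peaksL (b ∷ v)) (peaksL (b ∷ w))) (insertions m v) →
         All (λ w → OrSuc (peaksL (a ∷ b ∷ v)) (peaksL (a ∷ b ∷ w))) (insertions m v)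
  rest []      _           _              _  = last ∷ []
    where
    last : OrSuc 0 (peakAt a b m ℕ.+ 0)
    last rewrite peakAt-min a b m<b = bit-OrSuc 0 (indicator-bit ⌊ a ℤ.<? b ⌋)
  rest (c ∷ v) (m<c ∷ m<v) (b≢c ∷ linked) ih =
    first (a ℤ.<? b) (c ℤ.<? b) ∷ AllP.map⁺ (All.map (OrSuc-+ (peakAt a b c)) (AllP.map⁻ (All.tail ih)))
    where
    first : Dec (a ℤ.< b) → Dec (c ℤ.< b) → OrSuc (peaksL (a ∷ b ∷ c ∷ v)) (peaksL (a ∷ b ∷ m ∷ c ∷ v))
    first (yes a<b) (yes c<b)
      rewrite peakAt-min a b m<b | peakAt-≮ˡ {b} {m} c (ℤP.<-asym m<b)
            | peaksL-min c v m<c | peakAt-< a<b c<b | peaksL-∷∷ b c v | headPeak-≮ˡ v (ℤP.<-asym c<b)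
            | ⌊⌋-true (a ℤ.<? b) a<b
      = OrSuc-+ 1 (bit-OrSuc (peaksL (c ∷ v)) (headBelow-bit c v))
    first (yes a<b) (no c≮b)
      rewrite peakAt-min a b m<b | peakAt-≮ˡ {b} {m} c (ℤP.<-asym m<b)
            | peaksL-min c v m<c | peakAt-≮ʳ a c≮b | peaksL-∷∷ b c v | headPeak-< v (≮∧≢⇒> c≮b b≢c)
            | ⌊⌋-true (a ℤ.<? b) a<b
      = inj₂ refl
    first (no a≮b) (yes c<b)
      rewrite peakAt-min a b m<b | peakAt-≮ˡ {b} {m} c (ℤP.<-asym m<b)
            | peaksL-min c v m<c | peakAt-≮ˡ {a} {b} c a≮b | peaksL-∷∷ b c v | headPeak-≮ˡ v (ℤP.<-asym c<b)
            | ⌊⌋-false (a ℤ.<? b) a≮b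
      = bit-OrSuc (peaksL (c ∷ v)) (headBelow-bit c v)
    first (no a≮b) (no c≮b)
      rewrite peakAt-min a b m<b | peakAt-≮ˡ {b} {m} c (ℤP.<-asym m<b)
            | peaksL-min c v m<c | peakAt-≮ˡ {a} {b} c a≮b | peaksL-∷∷ b c v | headPeak-< v (≮∧≢⇒> c≮b b≢c)
            | ⌊⌋-false (a ℤ.<? b) a≮b
      = inj₁ refl

peaksL-min-front : ∀ {m a b} v → m ℤ.< a → m ℤ.< b → a ℤ.< b →
                   peaksL (a ∷ m ∷ b ∷ v) ≡ peaksL (a ∷ b ∷ v)
peaksL-min-front {m} {a} {b} v m<a m<b a<b
  rewrite peaksL-∷∷ a b v | peakAt-≮ˡ {a} {m} b (ℤP.<-asym m<a) | peaksL-min b v m<b | headPeak-< v a<b = refl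

_≟ᵇ_ : ℕ → ℕ → Bool
m ≟ᵇ k = ⌊ m ℕ.≟ k ⌋

≟ᵇ-refl : ∀ m → (m ≟ᵇ m) ≡ true
≟ᵇ-refl m = ⌊⌋-true (m ℕ.≟ m) refl

≟ᵇ-≢ : ∀ {m k} → m ≢ k → (m ≟ᵇ k) ≡ false
≟ᵇ-≢ {m} {k} = ⌊⌋-false (m ℕ.≟ k)

≟ᵇ-suc : ∀ m k → (suc m ≟ᵇ suc k) ≡ (m ≟ᵇ k)
≟ᵇ-suc m k with m ℕ.≟ k
... | yes refl = ≟ᵇ-refl (suc m)
... | no  m≢k  = ≟ᵇ-≢ (m≢k ∘ ℕP.suc-injective)

ι-≟ᵇ-subst : ∀ m k (F : ℕ → ℤ) → ι (m ≟ᵇ k) ℤ.* F m ≡ ι (m ≟ᵇ k) ℤ.* F k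
ι-≟ᵇ-subst m k F with m ℕ.≟ k
... | yes refl = refl
... | no  _    = refl

module _ {A : Set} (f : A → ℕ) (P : ℕ) where

  countAt : ℕ → List A → ℕ
  countAt k = count (λ w → f w ≟ᵇ k)

  private
    P≢1+P : P ≢ suc P
    P≢1+P = ℕP.1+n≢n ∘ sym

  OrSuc-countAt-+ : ∀ ws → All (OrSuc P ∘ f) ws → countAt P ws ℕ.+ countAt (suc P) ws ≡ length ws
  OrSuc-countAt-+ []       _                 = refl
  OrSuc-countAt-+ (w ∷ ws) (inj₁ fw≡ ∷ rest) rewrite fw≡ | ≟ᵇ-refl P | ≟ᵇ-≢ P≢1+P =
    cong suc (OrSuc-countAt-+ ws rest)
  OrSuc-countAt-+ (w ∷ ws) (inj₂ fw≡ ∷ rest) rewrite fw≡ | ≟ᵇ-refl (suc P) | ≟ᵇ-≢ (P≢1+P ∘ sym) =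
    trans (ℕP.+-suc (countAt P ws) _) (cong suc (OrSuc-countAt-+ ws rest))

  OrSuc-sum : ∀ ws → All (OrSuc P ∘ f) ws → sumℕ f ws ≡ P ℕ.* length ws ℕ.+ countAt (suc P) ws
  OrSuc-sum []       _ = sym (trans (ℕP.+-identityʳ (P ℕ.* 0)) (ℕP.*-zeroʳ P))
  OrSuc-sum (w ∷ ws) (inj₁ fw≡ ∷ rest) rewrite fw≡ | ≟ᵇ-≢ P≢1+P | OrSuc-sum ws rest =
    lemma P (length ws) (countAt (suc P) ws)
    where lemma : ∀ P l c → P ℕ.+ (P ℕ.* l ℕ.+ c) ≡ P ℕ.* suc l ℕ.+ (0 ℕ.+ c)
          lemma = ℕSolver.solve-∀
  OrSuc-sum (w ∷ ws) (inj₂ fw≡ ∷ rest) rewrite fw≡ | ≟ᵇ-refl (suc P) | OrSuc-sum ws rest =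
    lemma P (length ws) (countAt (suc P) ws)
    where lemma : ∀ P l c → suc P ℕ.+ (P ℕ.* l ℕ.+ c) ≡ P ℕ.* suc l ℕ.+ (1 ℕ.+ c)
          lemma = ℕSolver.solve-∀

  OrSuc-countAt-other : ∀ ws → All (OrSuc P ∘ f) ws → ∀ {k} → P ≢ k → suc P ≢ k → countAt k ws ≡ 0
  OrSuc-countAt-other []       _                 P≢k 1+P≢k = refl
  OrSuc-countAt-other (w ∷ ws) (inj₁ fw≡ ∷ rest) P≢k 1+P≢k rewrite fw≡ | ≟ᵇ-≢ P≢k =
    OrSuc-countAt-other ws rest P≢k 1+P≢k
  OrSuc-countAt-other (w ∷ ws) (inj₂ fw≡ ∷ rest) P≢k 1+P≢k rewrite fw≡ | ≟ᵇ-≢ 1+P≢k =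
    OrSuc-countAt-other ws rest P≢k 1+P≢k

  OrSuc-countAt : ∀ ws → All (OrSuc P ∘ f) ws → ∀ k →
    + countAt k ws ≡ ι (P ≟ᵇ k) ℤ.* + countAt P ws ℤ.+ ι (suc P ≟ᵇ k) ℤ.* + countAt (suc P) ws
  OrSuc-countAt ws all k with P ℕ.≟ k | suc P ℕ.≟ k
  ... | yes refl | yes 1+P≡P = ⊥-elim (P≢1+P (sym 1+P≡P))
  ... | yes refl | no  _     = sym (trans (ℤP.+-identityʳ _) (ℤP.*-identityˡ _))
  ... | no  _    | yes refl  = sym (trans (ℤP.+-identityˡ _) (ℤP.*-identityˡ _))
  ... | no  P≢k  | no 1+P≢k  = cong +_ (OrSuc-countAt-other ws all P≢k 1+P≢k)

  OrSuc-sizesℕ : ∀ ws → All (OrSuc P ∘ f) ws → ∀ L d → length ws ≡ suc L →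
                 sumℕ f ws ℕ.+ 2 ℕ.* P ℕ.+ d ≡ P ℕ.* suc L ℕ.+ L →
                 countAt P ws ≡ 2 ℕ.* P ℕ.+ d ℕ.+ 1 × countAt (suc P) ws ℕ.+ 2 ℕ.* P ℕ.+ d ≡ L
  OrSuc-sizesℕ ws all L d len sum≡ = size₀ , size₁
    where
    c₁ : ℕ
    c₁ = countAt (suc P) ws
    size₁ : c₁ ℕ.+ 2 ℕ.* P ℕ.+ d ≡ L
    size₁ = ℕP.+-cancelˡ-≡ (P ℕ.* suc L) _ _ (begin
        P ℕ.* suc L ℕ.+ (c₁ ℕ.+ 2 ℕ.* P ℕ.+ d)
      ≡⟨ lemma (P ℕ.* suc L) c₁ (2 ℕ.* P) d ⟩
        P ℕ.* suc L ℕ.+ c₁ ℕ.+ 2 ℕ.* P ℕ.+ d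
      ≡⟨ cong (λ s → s ℕ.+ 2 ℕ.* P ℕ.+ d) (sym (trans (OrSuc-sum ws all) (cong (λ l → P ℕ.* l ℕ.+ c₁) len))) ⟩
        sumℕ f ws ℕ.+ 2 ℕ.* P ℕ.+ d
      ≡⟨ sum≡ ⟩
        P ℕ.* suc L ℕ.+ L ∎)
      where
      open ≡-Reasoning
      lemma : ∀ a b c d → a ℕ.+ (b ℕ.+ c ℕ.+ d) ≡ a ℕ.+ b ℕ.+ c ℕ.+ d
      lemma = ℕSolver.solve-∀
    size₀ : countAt P ws ≡ 2 ℕ.* P ℕ.+ d ℕ.+ 1
    size₀ = ℕP.+-cancelʳ-≡ c₁ _ _ (begin
        countAt P ws ℕ.+ c₁
      ≡⟨ trans (OrSuc-countAt-+ ws all) len ⟩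
        suc L
      ≡⟨ cong suc (sym size₁) ⟩
        suc (c₁ ℕ.+ 2 ℕ.* P ℕ.+ d)
      ≡⟨ lemma c₁ (2 ℕ.* P) d ⟩
        2 ℕ.* P ℕ.+ d ℕ.+ 1 ℕ.+ c₁ ∎)
      where
      open ≡-Reasoning
      lemma : ∀ a b c → suc (a ℕ.+ b ℕ.+ c) ≡ b ℕ.+ c ℕ.+ 1 ℕ.+ a
      lemma = ℕSolver.solve-∀

  OrSuc-sizes : ∀ ws → All (OrSuc P ∘ f) ws → ∀ L d → length ws ≡ suc L →
                sumℕ f ws ℕ.+ 2 ℕ.* P ℕ.+ d ≡ P ℕ.* suc L ℕ.+ L →
                + countAt P ws ≡ + 2 ℤ.* + P ℤ.+ + d ℤ.+ 1ℤ ×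
                + countAt (suc P) ws ≡ + L ℤ.- + 2 ℤ.* + P ℤ.- + d
  OrSuc-sizes ws all L d len sum≡ with OrSuc-sizesℕ ws all L d len sum≡
  ... | size₀ , size₁ = cast₀ (countAt P ws) size₀ , cast₁ (countAt (suc P) ws) size₁
    where
    +2P : + (2 ℕ.* P) ≡ + 2 ℤ.* + P
    +2P = ℤP.pos-* 2 P
    cast₀ : ∀ c → c ≡ 2 ℕ.* P ℕ.+ d ℕ.+ 1 → + c ≡ + 2 ℤ.* + P ℤ.+ + d ℤ.+ 1ℤ
    cast₀ _ refl = trans (ℤP.pos-+ (2 ℕ.* P ℕ.+ d) 1)
                         (cong (ℤ._+ 1ℤ) (trans (ℤP.pos-+ (2 ℕ.* P) d) (cong (ℤ._+ + d) +2P)))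
    cast₁ : ∀ c → c ℕ.+ 2 ℕ.* P ℕ.+ d ≡ L → + c ≡ + L ℤ.- + 2 ℤ.* + P ℤ.- + d
    cast₁ c refl = trans (lemma (+ c) (+ P) (+ d))
      (cong (λ z → z ℤ.- + 2 ℤ.* + P ℤ.- + d)
            (sym (trans (ℤP.pos-+ (c ℕ.+ 2 ℕ.* P) d) (cong (ℤ._+ + d) (trans (ℤP.pos-+ c (2 ℕ.* P))
                                                                                (cong (ℤ._+_ (+ c)) +2P))))))
      where lemma : ∀ c P d → c ≡ c ℤ.+ + 2 ℤ.* P ℤ.+ d ℤ.- + 2 ℤ.* P ℤ.- d
            lemma = ℤSolver.solve-∀

-- The recurrences for U and V

count-insertions-head : ∀ (q : Bool → Bool) (g : List ℤ → Bool) x b v →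
  + count (λ w → q (firstPositive w) ∧ g w) (insertions x (b ∷ v))
  ≡ ι (q ⌊ 0ℤ ℤ.<? x ⌋ ∧ g (x ∷ b ∷ v))
    ℤ.+ ι (q ⌊ 0ℤ ℤ.<? b ⌋) ℤ.* (+ count g (insertions x (b ∷ v)) ℤ.- ι (g (x ∷ b ∷ v)))
count-insertions-head q g x b v
  rewrite count-map (λ w → q (firstPositive w) ∧ g w) (b ∷_) (insertions x v)
        | count-map g (b ∷_) (insertions x v)
  with q ⌊ 0ℤ ℤ.<? b ⌋
... | true  = trans (ℤP.pos-+ i c) (cong (ℤ._+_ (+ i)) (trans (lemma (+ j) (+ c)) (cong (λ z → 1ℤ ℤ.* (z ℤ.- + j)) (sym (ℤP.pos-+ j c)))))
  where
  i j c : ℕ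
  i = indicator (q ⌊ 0ℤ ℤ.<? x ⌋ ∧ g (x ∷ b ∷ v))
  j = indicator (g (x ∷ b ∷ v))
  c = count (g ∘ (b ∷_)) (insertions x v)
  lemma : ∀ j c → c ≡ 1ℤ ℤ.* (j ℤ.+ c ℤ.- j)
  lemma = ℤSolver.solve-∀
... | false = trans (cong (λ c → + (i ℕ.+ c)) (count-false (insertions x v)))
                    (trans (cong +_ (ℕP.+-identityʳ i)) (sym (trans (cong (ℤ._+_ (+ i)) (ℤP.*-zeroˡ r)) (ℤP.+-identityʳ (+ i)))))
  where
  i : ℕ
  i = indicator (q ⌊ 0ℤ ℤ.<? x ⌋ ∧ g (x ∷ b ∷ v))
  r : ℤ
  r = + count g (insertions x (b ∷ v)) ℤ.- ι (g (x ∷ b ∷ v))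

Acoef Ccoef : ℕ → ℤ
Acoef k = + 4 ℤ.* + k ℤ.+ 1ℤ
Ccoef k = + 4 ℤ.* + k ℤ.+ + 3

Bcoef Dcoef : ℕ → ℕ → ℤ
Bcoef N j = + 2 ℤ.* + N ℤ.- + 4 ℤ.* + j
Dcoef N j = + 2 ℤ.* + N ℤ.- + 4 ℤ.* + j ℤ.- + 2

module ExtremeInsertion (N : ℕ) (b : ℤ) (v : List ℤ) (perm : IsSignedPerm N (b ∷ v)) where

  private
    bv : List ℤ
    bv = b ∷ v
    M m : ℤ
    M = + suc N
    m = -[1+ N ]
    P : ℕ
    P = pk bv
    E : ℕ → List ℤ → Bool
    E k w = pk w ≟ᵇ k

    inRange : All (InRange N) bv
    inRange = proj₁ (proj₂ perm)

    below-M : All (ℤ._< M) bv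
    below-M = All.map <M inRange
      where <M : ∀ {x} → InRange N x → x ℤ.< M
            <M {+ _}      (_ , ≤N) = +<+ (s≤s ≤N)
            <M { -[1+ _ ]} _       = -<+

    above-m : All (m ℤ.<_) bv
    above-m = All.map m< inRange
      where m< : ∀ {x} → InRange N x → m ℤ.< x
            m< {+ _}      _        = -<+
            m< { -[1+ _ ]} (_ , ≤N) = -<- ≤N

    b≢0 : b ≢ 0ℤ
    b≢0 b≡0 = ℕP.<-irrefl (cong ℤ.∣_∣ (sym b≡0)) (proj₁ (All.head inRange))

    adjacent-distinct : ∀ {x w} → Unique (map ℤ.∣_∣ (x ∷ w)) → Linked _≢_ (x ∷ w)
    adjacent-distinct {w = []}    _               = [-]
    adjacent-distinct {w = y ∷ w} ((x≢ ∷ _) ∷ u) = (x≢ ∘ cong ℤ.∣_∣) ∷ adjacent-distinct u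

    linked : Linked _≢_ (0ℤ ∷ bv)
    linked = (b≢0 ∘ sym) ∷ adjacent-distinct (proj₂ (proj₂ perm))

    counts : ∀ x d → All (OrSuc P ∘ pk) (insertions x bv) →
             peakSum x 0ℤ bv ℕ.+ 2 ℕ.* P ℕ.+ d ≡ P ℕ.* suc (length bv) ℕ.+ length bv → ∀ k →
             + count (E k) (insertions x bv)
             ≡ ι (P ≟ᵇ k) ℤ.* (+ 2 ℤ.* + P ℤ.+ + d ℤ.+ 1ℤ) ℤ.+ ι (suc P ≟ᵇ k) ℤ.* (+ N ℤ.- + 2 ℤ.* + P ℤ.- + d)
    counts x d all sum≡ k with OrSuc-sizes pk P (insertions x bv) all (length bv) d (length-insertions x bv) sum≡
    ... | size₀ , size₁ =
      trans (OrSuc-countAt pk P (insertions x bv) all k)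
            (cong₂ (λ s₀ s₁ → ι (P ≟ᵇ k) ℤ.* s₀ ℤ.+ ι (suc P ≟ᵇ k) ℤ.* s₁) size₀
                   (trans size₁ (cong (λ l → + l ℤ.- + 2 ℤ.* + P ℤ.- + d) (proj₁ perm))))

    countsM : ∀ k → + count (E k) (insertions M bv)
              ≡ ι (P ≟ᵇ k) ℤ.* (+ 2 ℤ.* + P ℤ.+ 0ℤ ℤ.+ 1ℤ) ℤ.+ ι (suc P ≟ᵇ k) ℤ.* (+ N ℤ.- + 2 ℤ.* + P ℤ.- 0ℤ)
    countsM = counts M 0 (insertions-max-OrSuc M 0ℤ bv (+<+ (s≤s z≤n)) below-M)
                         (trans (ℕP.+-identityʳ _) (peakSum-max M 0ℤ bv (+<+ (s≤s z≤n)) below-M))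

    countsm : ∀ k → + count (E k) (insertions m bv)
              ≡ ι (P ≟ᵇ k) ℤ.* (+ 2 ℤ.* + P ℤ.+ + less b 0ℤ ℤ.+ 1ℤ)
                ℤ.+ ι (suc P ≟ᵇ k) ℤ.* (+ N ℤ.- + 2 ℤ.* + P ℤ.- + less b 0ℤ)
    countsm = counts m (less b 0ℤ) (insertions-min-OrSuc m 0ℤ bv -<+ above-m linked)
                                   (peakSum-min m 0ℤ bv -<+ above-m linked)

    E-M-neg : ∀ k → ¬ 0ℤ ℤ.< b → E k (M ∷ bv) ≡ (suc P ≟ᵇ k)
    E-M-neg k b≯0 = cong (_≟ᵇ k) (peaksL-max-front v (+<+ (s≤s z≤n)) (All.head below-M) b≯0)

    E-m-pos : ∀ k → 0ℤ ℤ.< b → E k (m ∷ bv) ≡ (P ≟ᵇ k)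
    E-m-pos k 0<b = cong (_≟ᵇ k) (peaksL-min-front v -<+ (All.head above-m) 0<b)

    less-pos : 0ℤ ℤ.< b → + less b 0ℤ ≡ 0ℤ
    less-pos 0<b = cong ι (⌊⌋-false (b ℤ.<? 0ℤ) (ℤP.<-asym 0<b))

    less-neg : ¬ 0ℤ ℤ.< b → + less b 0ℤ ≡ 1ℤ
    less-neg b≯0 = cong ι (⌊⌋-true (b ℤ.<? 0ℤ) (≮∧≢⇒> b≯0 b≢0))

    split : ∀ (q : Bool → Bool) k →
      + count (λ w → q (firstPositive w) ∧ E k w) (insertExtremes N bv)
      ≡ (ι (q true ∧ E k (M ∷ bv)) ℤ.+ ι (q ⌊ 0ℤ ℤ.<? b ⌋) ℤ.* (+ count (E k) (insertions M bv) ℤ.- ι (E k (M ∷ bv))))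
        ℤ.+ (ι (q false ∧ E k (m ∷ bv)) ℤ.+ ι (q ⌊ 0ℤ ℤ.<? b ⌋) ℤ.* (+ count (E k) (insertions m bv) ℤ.- ι (E k (m ∷ bv))))
    split q k = trans (cong +_ (count-++ g (insertions M bv) (insertions m bv)))
                      (trans (ℤP.pos-+ (count g (insertions M bv)) _)
                             (cong₂ ℤ._+_ (count-insertions-head q (E k) M b v) (count-insertions-head q (E k) m b v)))
      where
      g : List ℤ → Bool
      g w = q (firstPositive w) ∧ E k w

  count-positive-insertExtremes : ∀ k →
    + count (λ w → firstPositive w ∧ E k w) (insertExtremes N bv)
    ≡ ι (⌊ 0ℤ ℤ.<? b ⌋ ∧ (P ≟ᵇ k)) ℤ.* Acoef k ℤ.+ ι (⌊ 0ℤ ℤ.<? b ⌋ ∧ (suc P ≟ᵇ k)) ℤ.* Bcoef N (k ℕ.∸ 1)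
      ℤ.+ ι (not ⌊ 0ℤ ℤ.<? b ⌋ ∧ (suc P ≟ᵇ k)) ℤ.* 1ℤ
  count-positive-insertExtremes k = trans (split id k) (cases (0ℤ ℤ.<? b))
    where
    cases : Dec (0ℤ ℤ.< b) →
      (ι (E k (M ∷ bv)) ℤ.+ ι ⌊ 0ℤ ℤ.<? b ⌋ ℤ.* (+ count (E k) (insertions M bv) ℤ.- ι (E k (M ∷ bv))))
      ℤ.+ (0ℤ ℤ.+ ι ⌊ 0ℤ ℤ.<? b ⌋ ℤ.* (+ count (E k) (insertions m bv) ℤ.- ι (E k (m ∷ bv))))
      ≡ ι (⌊ 0ℤ ℤ.<? b ⌋ ∧ (P ≟ᵇ k)) ℤ.* Acoef k ℤ.+ ι (⌊ 0ℤ ℤ.<? b ⌋ ∧ (suc P ≟ᵇ k)) ℤ.* Bcoef N (k ℕ.∸ 1)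
        ℤ.+ ι (not ⌊ 0ℤ ℤ.<? b ⌋ ∧ (suc P ≟ᵇ k)) ℤ.* 1ℤ
    cases (yes 0<b) with ⌊ 0ℤ ℤ.<? b ⌋ | ⌊⌋-true (0ℤ ℤ.<? b) 0<b
    ... | .true | refl =
      trans (algebra (ι (E k (M ∷ bv))) (ι (P ≟ᵇ k)) (ι (suc P ≟ᵇ k)) (+ P) (+ N)
                     (countsM k) (countsm k) (less-pos 0<b) (cong ι (E-m-pos k 0<b)))
            (cong₂ (λ x y → x ℤ.+ y ℤ.+ 0ℤ ℤ.* 1ℤ)
                   (ι-≟ᵇ-subst P k Acoef) (ι-≟ᵇ-subst (suc P) k (Bcoef N ∘ ℕ.pred)))
      where
      algebra : ∀ {cM cm d hm} hM i₀ i₁ P N →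
        cM ≡ i₀ ℤ.* (+ 2 ℤ.* P ℤ.+ 0ℤ ℤ.+ 1ℤ) ℤ.+ i₁ ℤ.* (N ℤ.- + 2 ℤ.* P ℤ.- 0ℤ) →
        cm ≡ i₀ ℤ.* (+ 2 ℤ.* P ℤ.+ d ℤ.+ 1ℤ) ℤ.+ i₁ ℤ.* (N ℤ.- + 2 ℤ.* P ℤ.- d) → d ≡ 0ℤ → hm ≡ i₀ →
        hM ℤ.+ 1ℤ ℤ.* (cM ℤ.- hM) ℤ.+ (0ℤ ℤ.+ 1ℤ ℤ.* (cm ℤ.- hm))
        ≡ i₀ ℤ.* (+ 4 ℤ.* P ℤ.+ 1ℤ) ℤ.+ i₁ ℤ.* (+ 2 ℤ.* N ℤ.- + 4 ℤ.* P) ℤ.+ 0ℤ ℤ.* 1ℤ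
      algebra hM i₀ i₁ P N refl refl refl refl = ring hM i₀ i₁ P N
        where ring : ∀ hM i₀ i₁ P N →
                hM ℤ.+ 1ℤ ℤ.* (i₀ ℤ.* (+ 2 ℤ.* P ℤ.+ 0ℤ ℤ.+ 1ℤ) ℤ.+ i₁ ℤ.* (N ℤ.- + 2 ℤ.* P ℤ.- 0ℤ) ℤ.- hM)
                ℤ.+ (0ℤ ℤ.+ 1ℤ ℤ.* (i₀ ℤ.* (+ 2 ℤ.* P ℤ.+ 0ℤ ℤ.+ 1ℤ) ℤ.+ i₁ ℤ.* (N ℤ.- + 2 ℤ.* P ℤ.- 0ℤ) ℤ.- i₀))
                ≡ i₀ ℤ.* (+ 4 ℤ.* P ℤ.+ 1ℤ) ℤ.+ i₁ ℤ.* (+ 2 ℤ.* N ℤ.- + 4 ℤ.* P) ℤ.+ 0ℤ ℤ.* 1ℤ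
              ring = ℤSolver.solve-∀
    cases (no b≯0) with ⌊ 0ℤ ℤ.<? b ⌋ | ⌊⌋-false (0ℤ ℤ.<? b) b≯0
    ... | .false | refl = algebra (cong ι (E-M-neg k b≯0))
      where
      algebra : ∀ {hM i₁} → hM ≡ i₁ → hM ℤ.+ 0ℤ ℤ.+ (0ℤ ℤ.+ 0ℤ) ≡ 0ℤ ℤ.+ 0ℤ ℤ.+ i₁ ℤ.* 1ℤ
      algebra {hM} refl = ring hM
        where ring : ∀ hM → hM ℤ.+ 0ℤ ℤ.+ (0ℤ ℤ.+ 0ℤ) ≡ 0ℤ ℤ.+ 0ℤ ℤ.+ hM ℤ.* 1ℤ
              ring = ℤSolver.solve-∀

  count-negative-insertExtremes : ∀ k →
    + count (λ w → not (firstPositive w) ∧ E k w) (insertExtremes N bv)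
    ≡ ι (⌊ 0ℤ ℤ.<? b ⌋ ∧ (P ≟ᵇ k)) ℤ.* 1ℤ ℤ.+ ι (not ⌊ 0ℤ ℤ.<? b ⌋ ∧ (P ≟ᵇ k)) ℤ.* Ccoef k
      ℤ.+ ι (not ⌊ 0ℤ ℤ.<? b ⌋ ∧ (suc P ≟ᵇ k)) ℤ.* Dcoef N (k ℕ.∸ 1)
  count-negative-insertExtremes k = trans (split not k) (cases (0ℤ ℤ.<? b))
    where
    cases : Dec (0ℤ ℤ.< b) →
      (0ℤ ℤ.+ ι (not ⌊ 0ℤ ℤ.<? b ⌋) ℤ.* (+ count (E k) (insertions M bv) ℤ.- ι (E k (M ∷ bv))))
      ℤ.+ (ι (E k (m ∷ bv)) ℤ.+ ι (not ⌊ 0ℤ ℤ.<? b ⌋) ℤ.* (+ count (E k) (insertions m bv) ℤ.- ι (E k (m ∷ bv))))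
      ≡ ι (⌊ 0ℤ ℤ.<? b ⌋ ∧ (P ≟ᵇ k)) ℤ.* 1ℤ ℤ.+ ι (not ⌊ 0ℤ ℤ.<? b ⌋ ∧ (P ≟ᵇ k)) ℤ.* Ccoef k
        ℤ.+ ι (not ⌊ 0ℤ ℤ.<? b ⌋ ∧ (suc P ≟ᵇ k)) ℤ.* Dcoef N (k ℕ.∸ 1)
    cases (yes 0<b) with ⌊ 0ℤ ℤ.<? b ⌋ | ⌊⌋-true (0ℤ ℤ.<? b) 0<b
    ... | .true | refl = algebra (cong ι (E-m-pos k 0<b))
      where
      algebra : ∀ {hm i₀} → hm ≡ i₀ → 0ℤ ℤ.+ 0ℤ ℤ.+ (hm ℤ.+ 0ℤ) ≡ i₀ ℤ.* 1ℤ ℤ.+ 0ℤ ℤ.+ 0ℤ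
      algebra {hm} refl = ring hm
        where ring : ∀ hm → 0ℤ ℤ.+ 0ℤ ℤ.+ (hm ℤ.+ 0ℤ) ≡ hm ℤ.* 1ℤ ℤ.+ 0ℤ ℤ.+ 0ℤ
              ring = ℤSolver.solve-∀
    cases (no b≯0) with ⌊ 0ℤ ℤ.<? b ⌋ | ⌊⌋-false (0ℤ ℤ.<? b) b≯0
    ... | .false | refl =
      trans (algebra (ι (E k (m ∷ bv))) (ι (P ≟ᵇ k)) (ι (suc P ≟ᵇ k)) (+ P) (+ N)
                     (countsM k) (countsm k) (less-neg b≯0) (cong ι (E-M-neg k b≯0)))
            (cong₂ (λ x y → 0ℤ ℤ.+ x ℤ.+ y)
                   (ι-≟ᵇ-subst P k Ccoef) (ι-≟ᵇ-subst (suc P) k (Dcoef N ∘ ℕ.pred)))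
      where
      algebra : ∀ {cM cm d hM} hm i₀ i₁ P N →
        cM ≡ i₀ ℤ.* (+ 2 ℤ.* P ℤ.+ 0ℤ ℤ.+ 1ℤ) ℤ.+ i₁ ℤ.* (N ℤ.- + 2 ℤ.* P ℤ.- 0ℤ) →
        cm ≡ i₀ ℤ.* (+ 2 ℤ.* P ℤ.+ d ℤ.+ 1ℤ) ℤ.+ i₁ ℤ.* (N ℤ.- + 2 ℤ.* P ℤ.- d) → d ≡ 1ℤ → hM ≡ i₁ →
        0ℤ ℤ.+ 1ℤ ℤ.* (cM ℤ.- hM) ℤ.+ (hm ℤ.+ 1ℤ ℤ.* (cm ℤ.- hm))
        ≡ 0ℤ ℤ.+ i₀ ℤ.* (+ 4 ℤ.* P ℤ.+ + 3) ℤ.+ i₁ ℤ.* (+ 2 ℤ.* N ℤ.- + 4 ℤ.* P ℤ.- + 2)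
      algebra hm i₀ i₁ P N refl refl refl refl = ring hm i₀ i₁ P N
        where ring : ∀ hm i₀ i₁ P N →
                0ℤ ℤ.+ 1ℤ ℤ.* (i₀ ℤ.* (+ 2 ℤ.* P ℤ.+ 0ℤ ℤ.+ 1ℤ) ℤ.+ i₁ ℤ.* (N ℤ.- + 2 ℤ.* P ℤ.- 0ℤ) ℤ.- i₁)
                ℤ.+ (hm ℤ.+ 1ℤ ℤ.* (i₀ ℤ.* (+ 2 ℤ.* P ℤ.+ 1ℤ ℤ.+ 1ℤ) ℤ.+ i₁ ℤ.* (N ℤ.- + 2 ℤ.* P ℤ.- 1ℤ) ℤ.- hm))
                ≡ 0ℤ ℤ.+ i₀ ℤ.* (+ 4 ℤ.* P ℤ.+ + 3) ℤ.+ i₁ ℤ.* (+ 2 ℤ.* N ℤ.- + 4 ℤ.* P ℤ.- + 2)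
              ring = ℤSolver.solve-∀

count⁺ count⁻ : List (List ℤ) → ℕ → ℕ
count⁺ ws k = count (λ w → firstPositive w ∧ (pk w ≟ᵇ k)) ws
count⁻ ws k = count (λ w → not (firstPositive w) ∧ (pk w ≟ᵇ k)) ws

sumℤ-indicators₃ : ∀ {A : Set} (q₁ q₂ q₃ : A → Bool) a b c xs →
  sumℤ (λ x → ι (q₁ x) ℤ.* a ℤ.+ ι (q₂ x) ℤ.* b ℤ.+ ι (q₃ x) ℤ.* c) xs
  ≡ a ℤ.* + count q₁ xs ℤ.+ b ℤ.* + count q₂ xs ℤ.+ c ℤ.* + count q₃ xs
sumℤ-indicators₃ q₁ q₂ q₃ a b c xs =
  trans (sumℤ-+ (λ x → ι (q₁ x) ℤ.* a ℤ.+ ι (q₂ x) ℤ.* b) (λ x → ι (q₃ x) ℤ.* c) xs)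
        (cong₂ ℤ._+_ (trans (sumℤ-+ (λ x → ι (q₁ x) ℤ.* a) (λ x → ι (q₂ x) ℤ.* b) xs)
                            (cong₂ ℤ._+_ (sumℤ-indicator q₁ a xs) (sumℤ-indicator q₂ b xs)))
                     (sumℤ-indicator q₃ c xs))


module _ (N : ℕ) (k : ℕ) where

  private
    S : List (List ℤ)
    S = signedPermsByInsertion (suc N)

    shifted : (Bool → Bool) → List (List ℤ) → ℕ
    shifted q = count (λ v → q (firstPositive v) ∧ (suc (pk v) ≟ᵇ k))

    nonempty : ∀ {v} → v ∈ S → ∃₂ λ b v′ → v ≡ b ∷ v′ × IsSignedPerm (suc N) (b ∷ v′)
    nonempty {b ∷ v′} v∈ = b , v′ , refl , byInsertion⇒isSignedPerm (suc N) v∈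
    nonempty {[]}     v∈ with byInsertion⇒isSignedPerm (suc N) v∈
    ... | () , _

  count⁺-suc : + count⁺ (signedPermsByInsertion (suc (suc N))) k
               ≡ Acoef k ℤ.* + count⁺ S k ℤ.+ Bcoef (suc N) (k ℕ.∸ 1) ℤ.* + shifted id S ℤ.+ 1ℤ ℤ.* + shifted not S
  count⁺-suc = trans (count-concatMap _ (insertExtremes (suc N)) S)
    (trans (sumℤ-cong _ _ S per-v)
           (sumℤ-indicators₃ _ _ _ (Acoef k) (Bcoef (suc N) (k ℕ.∸ 1)) 1ℤ S))
    where
    per-v : ∀ {v} → v ∈ S →
      + count (λ w → firstPositive w ∧ (pk w ≟ᵇ k)) (insertExtremes (suc N) v)
      ≡ ι (firstPositive v ∧ (pk v ≟ᵇ k)) ℤ.* Acoef k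
        ℤ.+ ι (firstPositive v ∧ (suc (pk v) ≟ᵇ k)) ℤ.* Bcoef (suc N) (k ℕ.∸ 1)
        ℤ.+ ι (not (firstPositive v) ∧ (suc (pk v) ≟ᵇ k)) ℤ.* 1ℤ
    per-v v∈ with nonempty v∈
    ... | b , v′ , refl , perm = ExtremeInsertion.count-positive-insertExtremes (suc N) b v′ perm k

  count⁻-suc : + count⁻ (signedPermsByInsertion (suc (suc N))) k
               ≡ 1ℤ ℤ.* + count⁺ S k ℤ.+ Ccoef k ℤ.* + count⁻ S k ℤ.+ Dcoef (suc N) (k ℕ.∸ 1) ℤ.* + shifted not S
  count⁻-suc = trans (count-concatMap _ (insertExtremes (suc N)) S)
    (trans (sumℤ-cong _ _ S per-v)
           (sumℤ-indicators₃ _ _ _ 1ℤ (Ccoef k) (Dcoef (suc N) (k ℕ.∸ 1)) S))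
    where
    per-v : ∀ {v} → v ∈ S →
      + count (λ w → not (firstPositive w) ∧ (pk w ≟ᵇ k)) (insertExtremes (suc N) v)
      ≡ ι (firstPositive v ∧ (pk v ≟ᵇ k)) ℤ.* 1ℤ
        ℤ.+ ι (not (firstPositive v) ∧ (pk v ≟ᵇ k)) ℤ.* Ccoef k
        ℤ.+ ι (not (firstPositive v) ∧ (suc (pk v) ≟ᵇ k)) ℤ.* Dcoef (suc N) (k ℕ.∸ 1)
    per-v v∈ with nonempty v∈
    ... | b , v′ , refl , perm = ExtremeInsertion.count-negative-insertExtremes (suc N) b v′ perm k

shifted-zero : ∀ (q : Bool → Bool) ws → count (λ v → q (firstPositive v) ∧ (suc (pk v) ≟ᵇ 0)) ws ≡ 0
shifted-zero q ws =
  trans (count-cong _ _ ws (λ {v} _ → BoolP.∧-zeroʳ (q (firstPositive v)))) (count-false ws)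

shifted-suc : ∀ (q : Bool → Bool) ws j → count (λ v → q (firstPositive v) ∧ (suc (pk v) ≟ᵇ suc j)) ws
                                         ≡ count (λ v → q (firstPositive v) ∧ (pk v ≟ᵇ j)) ws
shifted-suc q ws j = count-cong _ _ ws (λ {v} _ → cong (q (firstPositive v) ∧_) (≟ᵇ-suc (pk v) j))

countStat-Cplus : ∀ (st : List ℤ → ℕ) n k →
  countStat st (Cplus n) k ≡ count (λ w → firstPositive w ∧ (st w ≟ᵇ k)) (signedPermsByInsertion n)
countStat-Cplus st n k = begin
    length (filter (λ w → st w ℕ.≟ k) (Cplus n))
  ≡⟨ length-filter (λ w → st w ℕ.≟ k) (Cplus n) ⟩
    count (λ w → st w ≟ᵇ k) (filter (λ w → firstPositive w Data.Bool.≟ true) (signedPerms n))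
  ≡⟨ count-filter (λ w → firstPositive w Data.Bool.≟ true) _ (signedPerms n) ⟩
    count (λ w → ⌊ firstPositive w Data.Bool.≟ true ⌋ ∧ (st w ≟ᵇ k)) (signedPerms n)
  ≡⟨ count-cong _ _ (signedPerms n) (λ {w} _ → cong (_∧ (st w ≟ᵇ k)) (≟-true (firstPositive w))) ⟩
    count (λ w → firstPositive w ∧ (st w ≟ᵇ k)) (signedPerms n)
  ≡⟨ count-↭ _ (signedPerms↭byInsertion n) ⟩
    count (λ w → firstPositive w ∧ (st w ≟ᵇ k)) (signedPermsByInsertion n) ∎
  where
  open ≡-Reasoning
  ≟-true : ∀ b → ⌊ b Data.Bool.≟ true ⌋ ≡ b
  ≟-true true  = refl
  ≟-true false = refl

negate : List ℤ → List ℤ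
negate = map (λ x → ℤ.- x)

negate-involutive : ∀ w → negate (negate w) ≡ w
negate-involutive []      = refl
negate-involutive (x ∷ w) = cong₂ _∷_ (ℤP.neg-involutive x) (negate-involutive w)

valleysL-negate : ∀ l → valleysL (negate l) ≡ peaksL l
valleysL-negate (a ∷ b ∷ c ∷ l) =
  cong₂ ℕ._+_ (cong₂ (λ x y → if x ∧ y then 1 else 0) (neg-<? b a) (neg-<? b c)) (valleysL-negate (b ∷ c ∷ l))
  where
  neg-<? : ∀ x y → ⌊ ℤ.- x ℤ.<? ℤ.- y ⌋ ≡ ⌊ y ℤ.<? x ⌋
  neg-<? x y with y ℤ.<? x
  ... | yes y<x = ⌊⌋-true  (ℤ.- x ℤ.<? ℤ.- y) (ℤP.neg-mono-< y<x)
  ... | no  y≮x = ⌊⌋-false (ℤ.- x ℤ.<? ℤ.- y) (y≮x ∘ ℤP.neg-cancel-<)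
valleysL-negate []          = refl
valleysL-negate (_ ∷ [])     = refl
valleysL-negate (_ ∷ _ ∷ []) = refl

isSignedPerm-negate : ∀ n w → IsSignedPerm n w → IsSignedPerm n (negate w)
isSignedPerm-negate n w (len , inRange , unique) =
  trans (ListP.length-map (λ x → ℤ.- x) w) len ,
  AllP.map⁺ (All.map (λ {x} → subst (λ a → 0 ℕ.< a × a ℕ.≤ n) (sym (ℤP.∣-i∣≡∣i∣ x))) inRange) ,
  subst Unique (sym (trans (sym (ListP.map-∘ w)) (ListP.map-cong ℤP.∣-i∣≡∣i∣ w))) unique

negate-↭ : ∀ n → map negate (signedPermsByInsertion n) ↭ signedPermsByInsertion n
negate-↭ n = unique-same-elements⇒↭
  (UniqueP.map⁺ (ListP.map-injective ℤP.neg-injective) (byInsertion-unique n)) (byInsertion-unique n)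
  negated∈
  (λ {w} w∈ → subst (_∈ map negate (signedPermsByInsertion n)) (negate-involutive w)
                (∈-map⁺ negate (isSignedPerm⇒byInsertion n _ (isSignedPerm-negate n w (byInsertion⇒isSignedPerm n w∈)))))
  where
  negated∈ : ∀ {u} → u ∈ map negate (signedPermsByInsertion n) → u ∈ signedPermsByInsertion n
  negated∈ u∈ with ∈-map⁻ negate u∈
  ... | w , w∈ , refl = isSignedPerm⇒byInsertion n _ (isSignedPerm-negate n w (byInsertion⇒isSignedPerm n w∈))

firstPositive-negate : ∀ b v → b ≢ 0ℤ → firstPositive (negate (b ∷ v)) ≡ not (firstPositive (b ∷ v))
firstPositive-negate b v b≢0 with 0ℤ ℤ.<? b
... | yes 0<b = ⌊⌋-false (0ℤ ℤ.<? ℤ.- b) (ℤP.<-asym 0<b ∘ subst (ℤ._< 0ℤ) (ℤP.neg-involutive b) ∘ ℤP.neg-mono-<)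
... | no  0≮b = ⌊⌋-true (0ℤ ℤ.<? ℤ.- b) (ℤP.neg-mono-< (≮∧≢⇒> 0≮b b≢0))

count-val≡count⁻ : ∀ n k → count (λ w → firstPositive w ∧ (val w ≟ᵇ k)) (signedPermsByInsertion (suc n))
                           ≡ count⁻ (signedPermsByInsertion (suc n)) k
count-val≡count⁻ n k = begin
    count g S
  ≡⟨ count-↭ g (negate-↭ (suc n)) ⟨
    count g (map negate S)
  ≡⟨ count-map g negate S ⟩
    count (g ∘ negate) S
  ≡⟨ count-cong _ _ S g∘negate ⟩
    count⁻ S k ∎
  where
  open ≡-Reasoning
  S : List (List ℤ)
  S = signedPermsByInsertion (suc n)
  g : List ℤ → Bool
  g w = firstPositive w ∧ (val w ≟ᵇ k)
  g∘negate : ∀ {w} → w ∈ S → g (negate w) ≡ not (firstPositive w) ∧ (pk w ≟ᵇ k)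
  g∘negate {w} w∈ with byInsertion⇒isSignedPerm (suc n) w∈
  g∘negate {b ∷ w} w∈ | _ , (0<∣b∣ , _) ∷ _ , _ =
    cong₂ _∧_ (firstPositive-negate b w (λ b≡0 → ℕP.<-irrefl (cong ℤ.∣_∣ (sym b≡0)) 0<∣b∣))
              (cong (_≟ᵇ k) (valleysL-negate (0ℤ ∷ b ∷ w)))

U-count⁺ : ∀ n k → U (suc n) k ≡ + count⁺ (signedPermsByInsertion (suc n)) k
U-count⁺ n k = cong +_ (countStat-Cplus pk (suc n) k)

V-count⁻ : ∀ n k → V (suc n) k ≡ + count⁻ (signedPermsByInsertion (suc n)) k
V-count⁻ n k = cong +_ (trans (countStat-Cplus val (suc n) k) (count-val≡count⁻ n k))

private
  combination-cong : ∀ {x y z x′ y′ z′} a b c → x ≡ x′ → y ≡ y′ → z ≡ z′ →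
                     a ℤ.* x ℤ.+ b ℤ.* y ℤ.+ c ℤ.* z ≡ a ℤ.* x′ ℤ.+ b ℤ.* y′ ℤ.+ c ℤ.* z′
  combination-cong a b c refl refl refl = refl

UV-recurrence-zero : EvenOddRecurrence 0 (U 0) (V 0) (U 1) (V 1)
UV-recurrence-zero = record
  { u′-zero = refl
  ; u′-suc  = λ { zero → refl ; (suc j) → sym (zero-combination (+ 4 ℤ.* + suc (suc j) ℤ.+ 1ℤ) (ℤ.- (+ 4 ℤ.* + suc j))) }
  ; v′-zero = refl
  ; v′-suc  = λ j → sym (zero-combination′ (+ 4 ℤ.* + suc j ℤ.+ + 3) (+ 2 ℤ.* 0ℤ ℤ.- + 4 ℤ.* + j ℤ.- + 2) (V 0 j)
                                           (V₀≡0 j))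
  }
  where
  zero-combination : ∀ a b → a ℤ.* 0ℤ ℤ.+ b ℤ.* 0ℤ ℤ.+ 0ℤ ≡ 0ℤ
  zero-combination = ℤSolver.solve-∀
  V₀≡0 : ∀ j → V 0 j ≡ 0ℤ
  V₀≡0 zero    = refl
  V₀≡0 (suc j) = refl
  zero-combination′ : ∀ a b v → v ≡ 0ℤ → 0ℤ ℤ.+ a ℤ.* 0ℤ ℤ.+ b ℤ.* v ≡ 0ℤ
  zero-combination′ a b _ refl = ring a b
    where ring : ∀ a b → 0ℤ ℤ.+ a ℤ.* 0ℤ ℤ.+ b ℤ.* 0ℤ ≡ 0ℤ
          ring = ℤSolver.solve-∀
UV-recurrence-suc : ∀ n → EvenOddRecurrence (suc n) (U (suc n)) (V (suc n)) (U (suc (suc n))) (V (suc (suc n)))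
UV-recurrence-suc n = record
  { u′-zero = trans (U-count⁺ (suc n) 0)
                    (trans (count⁺-suc n 0)
                           (trans (cong₂ (λ x y → Acoef 0 ℤ.* + count⁺ S 0 ℤ.+ Bcoef (suc n) 0 ℤ.* + x ℤ.+ 1ℤ ℤ.* + y)
                                         (shifted-zero id S) (shifted-zero not S))
                                  (trans (ring₀ (+ count⁺ S 0) (Bcoef (suc n) 0)) (sym (U-count⁺ n 0)))))
  ; u′-suc  = λ j → trans (U-count⁺ (suc n) (suc j))
                    (trans (count⁺-suc n (suc j))
                           (trans (combination-cong (Acoef (suc j)) (Bcoef (suc n) j) 1ℤ
                                    (sym (U-count⁺ n (suc j)))
                                    (trans (cong +_ (shifted-suc id S j)) (sym (U-count⁺ n j)))
                                    (trans (cong +_ (shifted-suc not S j)) (sym (V-count⁻ n j))))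
                                  (cong (ℤ._+_ (Acoef (suc j) ℤ.* U (suc n) (suc j) ℤ.+ Bcoef (suc n) j ℤ.* U (suc n) j))
                                        (ℤP.*-identityˡ (V (suc n) j)))))
  ; v′-zero = trans (V-count⁻ (suc n) 0)
                    (trans (count⁻-suc n 0)
                           (trans (cong (λ y → 1ℤ ℤ.* + count⁺ S 0 ℤ.+ Ccoef 0 ℤ.* + count⁻ S 0 ℤ.+ Dcoef (suc n) 0 ℤ.* + y)
                                        (shifted-zero not S))
                                  (trans (ring₁ (+ count⁺ S 0) (+ count⁻ S 0) (Dcoef (suc n) 0))
                                         (sym (cong₂ (λ u v → u ℤ.+ + 3 ℤ.* v) (U-count⁺ n 0) (V-count⁻ n 0))))))
  ; v′-suc  = λ j → trans (V-count⁻ (suc n) (suc j))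
                    (trans (count⁻-suc n (suc j))
                           (trans (combination-cong 1ℤ (Ccoef (suc j)) (Dcoef (suc n) j)
                                    (sym (U-count⁺ n (suc j)))
                                    (sym (V-count⁻ n (suc j)))
                                    (trans (cong +_ (shifted-suc not S j)) (sym (V-count⁻ n j))))
                                  (cong (λ x → x ℤ.+ Ccoef (suc j) ℤ.* V (suc n) (suc j) ℤ.+ Dcoef (suc n) j ℤ.* V (suc n) j)
                                        (ℤP.*-identityˡ (U (suc n) (suc j))))))
  }
  where
  S : List (List ℤ)
  S = signedPermsByInsertion (suc n)
  ring₀ : ∀ u b → Acoef 0 ℤ.* u ℤ.+ b ℤ.* 0ℤ ℤ.+ 1ℤ ℤ.* 0ℤ ≡ u
  ring₀ = ℤSolver.solve-∀
  ring₁ : ∀ u v d → 1ℤ ℤ.* u ℤ.+ Ccoef 0 ℤ.* v ℤ.+ d ℤ.* 0ℤ ≡ u ℤ.+ + 3 ℤ.* v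
  ring₁ = ℤSolver.solve-∀

UV-recurrence : ∀ n → EvenOddRecurrence n (U n) (V n) (U (suc n)) (V (suc n))
UV-recurrence zero    = UV-recurrence-zero
UV-recurrence (suc n) = UV-recurrence-suc n

proposition2p11 : (n k : ℕ) → H n k ≡ (subst-x² (U n) +P X *P subst-x² (V n)) k
proposition2p11 zero = ≗-interleave (H 0) (U 0) (V 0) even odd
  where
  even : ∀ j → H 0 (j ℕ.* 2) ≡ U 0 j
  even zero    = refl
  even (suc j) = refl
  odd : ∀ j → H 0 (suc (j ℕ.* 2)) ≡ V 0 j
  odd zero    = refl
  odd (suc j) = refl
proposition2p11 (suc n) k =
  trans (H-suc n k) (trans (stepH-cong n (proposition2p11 n) k) (stepH-interleave (UV-recurrence n) k))
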